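{- Let $G$ be a connected pseudograph with $r \geq 1$ redundant edges, and let $G_s$ be its underlying simple graph, viewed as a tube of $G$. Then the facet of $\mathcal{K}G$ corresponding to the tube $G_s$ is isomorphic to $\mathcal{K}G_s \times \mathcal{P}_r$.
   Context: A pseudograph is a finite graph in which loops and multiple edges are allowed. Two non-loop edges lie in the same bundle iff they have the same pair of endpoints. The underlying simple graph $G_s$ is obtained from $G$ by deleting all loops and replacing each bundle by a single one of its edges; it is a subgraph of $G$. The number $r$ of redundant edges is the minimal number of edges (loops included) to remove from $G$ to get a simple graph. For a connected pseudograph $H$: a tube is a proper connected subgraph $t$ such that whenever two nodes of $t$ are joined by at least one edge of $H$, $t$ contains at least one edge joining them; two tubes are compatible if one properly contains the other or if they are disjoint and cannot be connected by a single edge of $H$; a tubing is a set of pairwise compatible tubes. $\mathcal{K}H$ is the pseudograph associahedron: the simple polytope (or polytopal cone, if $H$ has loops) whose face poset is isomorphic to the poset of tubings under reverse inclusion; the facet corresponding to a tube $u$ has as subfaces the tubings containing $u$. $\mathcal{P}_r$ is the $(r-1)$-dimensional permutohedron. "Isomorphic" means having isomorphic face posets. -}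

module Defs where

open import Data.Nat using (ℕ; zero; suc; _≤_; _<ᵇ_)
open import Data.Bool using (Bool; true; false; not; _∧_; _∨_; if_then_else_)
open import Data.Fin using (Fin; toℕ; _≟_)
import Data.Fin as F
open import Data.Fin.Subset using (Subset; inside; outside; ⊤; ∣_∣)
import Data.Fin.Subset as S
open import Data.List using (List; []; _∷_; length; lookup; map; allFin; filterᵇ)
open import Data.Bool.ListAction using (any)
import Data.List.Membership.Propositional as LM
open import Data.List.Relation.Unary.All using (All)
open import Data.Vec using (Vec; tabulate)
import Data.Vec as V
open import Data.Product using (Σ; ∃; ∃-syntax; _×_; _,_; proj₁; proj₂)
open import Data.Sum using (_⊎_)
open import Relation.Nullary using (¬_; does)
open import Relation.Binary.PropositionalEquality using (_≡_; _≢_)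

-- Pseudographs: nodes Fin n, edges = positions in a list of endpoint pairs.
-- An edge e with ends (x , x) is a loop. Multiple edges allowed.

Pseudograph : ℕ → Set
Pseudograph n = List (Fin n × Fin n)

module _ {n : ℕ} (G : Pseudograph n) where

  Edge : Set
  Edge = Fin (length G)

  ends : Edge → Fin n × Fin n
  ends e = lookup G e

  Joins : Edge → Fin n → Fin n → Set
  Joins e x y = (ends e ≡ (x , y)) ⊎ (ends e ≡ (y , x))

  IsLoop : Edge → Set
  IsLoop e = proj₁ (ends e) ≡ proj₂ (ends e)

  Sub : Set
  Sub = Subset n × Subset (length G)

  IsSubgraph : Sub → Set
  IsSubgraph (N , E) = ∀ e → e S.∈ E → (proj₁ (ends e) S.∈ N) × (proj₂ (ends e) S.∈ N)

  data Walk (E : Subset (length G)) : Fin n → Fin n → Set where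
    here : ∀ {x} → Walk E x x
    step : ∀ {x y z} (e : Edge) → e S.∈ E → Joins e x y → Walk E y z → Walk E x z

  ConnectedSub : Sub → Set
  ConnectedSub (N , E) =
    (∃[ x ] x S.∈ N) × (∀ x y → x S.∈ N → y S.∈ N → Walk E x y)

  whole : Sub
  whole = (⊤ , ⊤)

  Connected : Set
  Connected = ConnectedSub whole

  IsTube : Sub → Set
  IsTube t@(N , E) =
    IsSubgraph t × ConnectedSub t × (t ≢ whole) ×
    (∀ x y → x S.∈ N → y S.∈ N → x ≢ y → (∃[ e ] Joins e x y) →
       ∃[ e ] (e S.∈ E × Joins e x y))

  _⊆ₛ_ : Sub → Sub → Set
  (N , E) ⊆ₛ (N' , E') = (N S.⊆ N') × (E S.⊆ E')

  _⊂ₛ_ : Sub → Sub → Set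
  t ⊂ₛ t' = (t ⊆ₛ t') × (t ≢ t')

  Compatible : Sub → Sub → Set
  Compatible t@(N , E) t'@(N' , E') =
    (t ⊂ₛ t') ⊎ (t' ⊂ₛ t) ⊎
    ((∀ x → x S.∈ N → ¬ (x S.∈ N')) ×
     ¬ (∃[ e ] ∃[ x ] ∃[ y ] (x S.∈ N × y S.∈ N' × Joins e x y)))

  IsTubing : List Sub → Set
  IsTubing T = All IsTube T ×
    (∀ t t' → t LM.∈ T → t' LM.∈ T → t ≢ t' → Compatible t t')

  Tubing : Set
  Tubing = Σ (List Sub) IsTubing

-- Face posets, presented as a carrier with a preorder (the poset is its
-- antisymmetric quotient; x ≈ y iff x ≤ y and y ≤ x).

record FacePoset : Set₁ where
  field
    Face : Set
    _⊑_  : Face → Face → Set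

open FacePoset

record _≅_ (P Q : FacePoset) : Set where
  field
    to   : Face P → Face Q
    from : Face Q → Face P
    to-mono   : ∀ x y → _⊑_ P x y → _⊑_ Q (to x) (to y)
    to-refl   : ∀ x y → _⊑_ Q (to x) (to y) → _⊑_ P x y
    from-to   : ∀ x → _⊑_ P (from (to x)) x × _⊑_ P x (from (to x))
    to-from   : ∀ y → _⊑_ Q (to (from y)) y × _⊑_ Q y (to (from y))

_×ᴾ_ : FacePoset → FacePoset → FacePoset
P ×ᴾ Q = record
  { Face = Face P × Face Q
  ; _⊑_  = λ a b → _⊑_ P (proj₁ a) (proj₁ b) × _⊑_ Q (proj₂ a) (proj₂ b) }

𝒦 : ∀ {n} → Pseudograph n → FacePoset
𝒦 G = record
  { Face = Tubing G
  ; _⊑_  = λ T T' → ∀ t → t LM.∈ proj₁ T' → t LM.∈ proj₁ T }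

facet : ∀ {n} (G : Pseudograph n) → Sub G → FacePoset
facet G u = record
  { Face = Σ (Tubing G) (λ T → u LM.∈ proj₁ T)
  ; _⊑_  = λ T T' → ∀ t → t LM.∈ proj₁ (proj₁ T') → t LM.∈ proj₁ (proj₁ T) }

-- 𝒫_r, the (r-1)-dimensional permutohedron: faces = ordered set partitions
-- of Fin r into k nonempty blocks, coded by a surjection Fin r → Fin k
-- (block index). Face f ⊆ face g iff g is an order-compatible coarsening of f.
OrderedPartition : ℕ → Set
OrderedPartition r = Σ ℕ λ k → Σ (Vec (Fin k) r) λ v → ∀ j → ∃[ i ] V.lookup v i ≡ j

𝒫 : ℕ → FacePoset
𝒫 r = record
  { Face = OrderedPartition r
  ; _⊑_  = λ { (k , v , _) (k' , v' , _) →
      Σ (Fin k → Fin k') λ h → ((∀ a b → a F.≤ b → h a F.≤ h b) ×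
              (∀ i → V.lookup v' i ≡ h (V.lookup v i))) } }

module _ {n : ℕ} (G : Pseudograph n) where

  sameBundleᵇ : Fin n × Fin n → Fin n × Fin n → Bool
  sameBundleᵇ (x , y) (x' , y') =
    (does (x ≟ x') ∧ does (y ≟ y')) ∨ (does (x ≟ y') ∧ does (y ≟ x'))

  keepᵇ : Edge G → Bool
  keepᵇ e = not (does (proj₁ (ends G e) ≟ proj₂ (ends G e))) ∧
    not (any (λ j → (toℕ j <ᵇ toℕ e) ∧ sameBundleᵇ (ends G j) (ends G e))
             (allFin (length G)))

  underlying : Pseudograph n
  underlying = map (ends G) (filterᵇ keepᵇ (allFin (length G)))

  underlyingTube : Sub G
  underlyingTube = (⊤ , tabulate (λ e → if keepᵇ e then inside else outside))

  SimpleAfterRemoving : Subset (length G) → Set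
  SimpleAfterRemoving R =
    (∀ e → ¬ (e S.∈ R) → ¬ IsLoop G e) ×
    (∀ e e' → ¬ (e S.∈ R) → ¬ (e' S.∈ R) → e ≢ e' →
       ¬ Joins G e' (proj₁ (ends G e)) (proj₂ (ends G e)))

  RedundantCount : ℕ → Set
  RedundantCount r =
    (∃[ R ] (SimpleAfterRemoving R × ∣ R ∣ ≡ r)) ×
    (∀ R → SimpleAfterRemoving R → r ≤ ∣ R ∣)

module Submission where

-- Since u contains every node, each other tube of a tubing containing u is
-- either strictly below u or strictly above u.  Tubes below u are exactly the
-- tubes of the simple graph G_s (transported along the bijection between
-- edges of G_s and kept edges of G), with the same compatibility relation.
-- Tubes above u are spanning: G_s plus a proper nonempty set of redundant
-- edges; they are pairwise nested, so a tubing contributes a chain of proper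
-- subsets of the ρ redundant edges, which is the cut set of a unique face of
-- the permutohedron 𝒫_ρ.

open import Defs
open import Data.Nat using (ℕ; zero; suc; _≤_; _<_; z≤n; s≤s; z<s; s<s; pred; s≤s⁻¹; s<s⁻¹; _<?_; _≤?_)
  renaming (_≟_ to _≟ℕ_)
open import Data.Nat.Properties
  using (<-cmp; <-trans; <-≤-trans; ≤-<-trans; ≤-trans; ≤-antisym; <-irrefl; <⇒≤; <⇒≱; <⇒≢; ≰⇒>; ≮⇒≥;
         ≤∧≢⇒<; n<1+n; m<n⇒m<1+n; m≤n⇒m≤1+n)
open import Data.Bool using (Bool; true; false; T; not; _∧_; if_then_else_)
open import Data.Bool.Properties using (T-≡; not-injective; ∧-zeroʳ) renaming (_≟_ to _≟𝔹_)
open import Data.Bool.ListAction using (any)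
open import Data.Fin using (Fin; toℕ; fromℕ<; Fin′; _≟_)
import Data.Fin as F
import Data.Fin.Properties as FinP
open import Data.Fin.Subset using (Subset; inside; outside; _∈_; _∉_; _⊆_; ⊤; _∩_; ∣_∣; Nonempty)
open import Data.Fin.Subset.Properties
  using (_∈?_; _⊆?_; ∈⊤; ⊆-antisym; x∈p∩q⁺; x∈p∩q⁻; p∩q⊆p; ∩-identityʳ)
open import Data.Vec using (_∷_; here; there)
import Data.Vec as Vec
open import Data.Vec.Properties using ([]=⇒lookup; lookup⇒[]=; lookup∘tabulate)
import Data.Vec.Properties as VecP
open import Data.List using (List; []; _∷_; length; lookup; map; _++_; filter; filterᵇ; allFin; upTo)
import Data.List.Membership.Propositional as LM
open import Data.List.Membership.Propositional using (lose)
import Data.List.Membership.DecPropositional as DecMembership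
open import Data.List.Membership.Propositional.Properties
  using (∈-map⁺; ∈-map⁻; ∈-upTo⁺; ∈-upTo⁻; ∈-allFin; ∈-filter⁺; ∈-filter⁻; ∈-++⁺ˡ; ∈-++⁺ʳ; ∈-++⁻)
import Data.List.Relation.Unary.Any as Any
open import Data.List.Relation.Unary.Any.Properties using (any⁺; any⁻)
import Data.List.Relation.Unary.All as All
import Data.List.Relation.Unary.AllPairs as AllPairs
open import Data.List.Relation.Unary.Unique.Propositional using (Unique)
import Data.List.Relation.Unary.Unique.Propositional.Properties as Unique
open import Data.Product using (Σ; ∃-syntax; _×_; _,_; proj₁; proj₂; swap)
open import Data.Product.Properties using (≡-dec)
open import Data.Sum using (_⊎_; inj₁; inj₂)
open import Data.Empty using (⊥; ⊥-elim)
open import Relation.Nullary using (¬_; Dec; yes; no; does)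
open import Relation.Nullary.Decidable using (_×-dec_; _⊎-dec_; ¬?; dec-true; T?)
open import Relation.Binary.Definitions using (DecidableEquality; tri<; tri≈; tri>)
open import Relation.Binary.PropositionalEquality using (_≡_; _≢_; refl; sym; trans; cong; cong₂; subst)
open import Function using (_∘_; id)
open import Function.Bundles using (Equivalence)
open FacePoset

subsetOf : ∀ {m} {P : Fin m → Set} → (∀ i → Dec (P i)) → Subset m
subsetOf P? = Vec.tabulate (λ i → does (P? i))

∈-tabulate⁺ : ∀ {m} (f : Fin m → Bool) i → f i ≡ true → i ∈ Vec.tabulate f
∈-tabulate⁺ f i fi = lookup⇒[]= i (Vec.tabulate f) (trans (lookup∘tabulate f i) fi)

∈-tabulate⁻ : ∀ {m} (f : Fin m → Bool) i → i ∈ Vec.tabulate f → f i ≡ true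
∈-tabulate⁻ f i i∈ = trans (sym (lookup∘tabulate f i)) ([]=⇒lookup i∈)

∈-subsetOf⁺ : ∀ {m} {P : Fin m → Set} (P? : ∀ i → Dec (P i)) {i} → P i → i ∈ subsetOf P?
∈-subsetOf⁺ P? {i} Pi = ∈-tabulate⁺ _ i (dec-true (P? i) Pi)

∈-subsetOf⁻ : ∀ {m} {P : Fin m → Set} (P? : ∀ i → Dec (P i)) {i} → i ∈ subsetOf P? → P i
∈-subsetOf⁻ P? {i} i∈ with P? i | ∈-tabulate⁻ _ i i∈
... | yes Pi | _ = Pi

_≟ₛ_ : ∀ {m} → DecidableEquality (Subset m)
_≟ₛ_ = VecP.≡-dec _≟𝔹_

⊈-witness : ∀ {m} (A B : Subset m) → ¬ (A ⊆ B) → ∃[ i ] (i ∈ A × i ∉ B)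
⊈-witness A B A⊈B with FinP.any? (λ i → (i ∈? A) ×-dec ¬? (i ∈? B))
... | yes w = w
... | no none = ⊥-elim (A⊈B inclusion)
  where
  inclusion : A ⊆ B
  inclusion {i} i∈A with i ∈? B
  ... | yes i∈B = i∈B
  ... | no i∉B = ⊥-elim (none (i , i∈A , i∉B))

-- The order on faces is
-- encoded by the cuts of p: the sets of elements lying in the first a
-- blocks, for 0 < a < k.  Reverse inclusion of cut sets is exactly the
-- face order, and every chain of proper nonempty subsets is the cut set
-- of some ordered partition.
module _ {r : ℕ} where

  blocks : OrderedPartition r → ℕ
  blocks (k , _ , _) = k

  rank : OrderedPartition r → Fin r → ℕ
  rank (k , v , _) i = toℕ (Vec.lookup v i)

  rank< : ∀ p i → rank p i < blocks p
  rank< (k , v , _) i = FinP.toℕ<n (Vec.lookup v i)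

  rank-surjective : ∀ p j → j < blocks p → ∃[ i ] rank p i ≡ j
  rank-surjective (k , v , surj) j j<k with surj (fromℕ< j<k)
  ... | i , vi≡j = i , trans (cong toℕ vi≡j) (FinP.toℕ-fromℕ< j<k)

  fromRank : (k : ℕ) (f : Fin r → ℕ) → (∀ i → f i < k) → (∀ j → j < k → ∃[ i ] f i ≡ j) →
             OrderedPartition r
  fromRank k f f<k onto = k , Vec.tabulate (λ i → fromℕ< (f<k i)) , surjective
    where
    surjective : ∀ j → ∃[ i ] Vec.lookup (Vec.tabulate (λ i → fromℕ< (f<k i))) i ≡ j
    surjective j with onto (toℕ j) (FinP.toℕ<n j)
    ... | i , fi≡j = i , FinP.toℕ-injective (trans (cong toℕ (lookup∘tabulate _ i))
                                             (trans (FinP.toℕ-fromℕ< (f<k i)) fi≡j))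

  rank-fromRank : ∀ k f f<k onto i → rank (fromRank k f f<k onto) i ≡ f i
  rank-fromRank k f f<k onto i =
    trans (cong toℕ (lookup∘tabulate _ i)) (FinP.toℕ-fromℕ< (f<k i))

  cut : OrderedPartition r → ℕ → Subset r
  cut p a = subsetOf (λ i → rank p i <? a)

  ∈-cut⁺ : ∀ p a i → rank p i < a → i ∈ cut p a
  ∈-cut⁺ p a i = ∈-subsetOf⁺ (λ i → rank p i <? a)

  ∈-cut⁻ : ∀ p a i → i ∈ cut p a → rank p i < a
  ∈-cut⁻ p a i = ∈-subsetOf⁻ (λ i → rank p i <? a)

  cut-mono : ∀ p a b → a ≤ b → cut p a ⊆ cut p b
  cut-mono p a b a≤b {i} i∈ = ∈-cut⁺ p b i (<-≤-trans (∈-cut⁻ p a i i∈) a≤b)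

  IsCut : OrderedPartition r → Subset r → Set
  IsCut p S = Σ ℕ λ a → 0 < a × a < blocks p × S ≡ cut p a

  Proper : Subset r → Set
  Proper S = Nonempty S × ∃[ i ] i ∉ S

  Comparable : Subset r → Subset r → Set
  Comparable S T = S ⊆ T ⊎ T ⊆ S

  cut-comparable : ∀ p S T → IsCut p S → IsCut p T → Comparable S T
  cut-comparable p S T (a , _ , _ , refl) (b , _ , _ , refl) with a ≤? b
  ... | yes a≤b = inj₁ (cut-mono p a b a≤b)
  ... | no a≰b = inj₂ (cut-mono p b a (<⇒≤ (≰⇒> a≰b)))

  cut-proper : ∀ p S → IsCut p S → Proper S
  cut-proper p S (a , 0<a , a<k , refl)
    with rank-surjective p 0 (<-trans 0<a a<k) | rank-surjective p (pred (blocks p)) (pred< a<k)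
    where pred< : ∀ {a k} → a < k → pred k < k
          pred< {k = suc k} _ = n<1+n k
  ... | first , rank≡0 | last , rank≡top =
    (first , ∈-cut⁺ p a first (subst (_< a) (sym rank≡0) 0<a)) ,
    (last , λ last∈ → <⇒≱ (∈-cut⁻ p a last last∈) (subst (a ≤_) (sym rank≡top) (≤pred a<k)))
    where ≤pred : ∀ {a k} → a < k → a ≤ pred k
          ≤pred {k = suc k} a<k = s≤s⁻¹ a<k

  cuts : OrderedPartition r → List (Subset r)
  cuts p = map (λ j → cut p (suc j)) (upTo (pred (blocks p)))

  ∈-cuts⁺ : ∀ p S → IsCut p S → S LM.∈ cuts p
  ∈-cuts⁺ p S (suc j , _ , a<k , refl) = ∈-map⁺ _ (∈-upTo⁺ (<pred a<k))
    where <pred : ∀ {j k} → suc j < k → j < pred k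
          <pred {k = suc k} lt = s<s⁻¹ lt

  ∈-cuts⁻ : ∀ p S → S LM.∈ cuts p → IsCut p S
  ∈-cuts⁻ p S S∈ with ∈-map⁻ _ S∈
  ... | j , j∈ , S≡ = suc j , z<s , pred< (∈-upTo⁻ j∈) , S≡
    where pred< : ∀ {j k} → j < pred k → suc j < k
          pred< {k = suc k} lt = s<s lt

  -- A coarsening p ⊑ p' merges consecutive blocks, so every cut of p' is a
  -- cut of p: the cut of p' below block a' is the cut of p below the first
  -- block that the coarsening sends to a' or beyond.
  ⊑⇒cuts : ∀ (p p' : OrderedPartition r) → _⊑_ (𝒫 r) p p' → ∀ S → IsCut p' S → IsCut p S
  ⊑⇒cuts p@(k , v , _) p'@(k' , v' , _) (h , h-mono , v'≡hv) S (a' , 0<a' , a'<k' , refl) =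
    a , 0<a , FinP.toℕ<n b₀ , ⊆-antisym cut'⊆cut cut⊆cut'
    where
    Below : Fin k → Set
    Below b = toℕ (h b) < a'
    rank'≡ : ∀ i → rank p' i ≡ toℕ (h (Vec.lookup v i))
    rank'≡ i = cong toℕ (v'≡hv i)
    notAllBelow : ¬ (∀ b → Below b)
    notAllBelow allBelow with rank-surjective p' a' a'<k'
    ... | i , rank≡a' = <-irrefl rank≡a' (subst (_< a') (sym (rank'≡ i)) (allBelow (Vec.lookup v i)))
    smallest = FinP.¬∀⟶∃¬-smallest k Below (λ b → toℕ (h b) <? a') notAllBelow
    b₀ : Fin k
    b₀ = proj₁ smallest
    a : ℕ
    a = toℕ b₀
    below : ∀ b → toℕ b < a → Below b
    below b b<a = subst Below (FinP.toℕ-injective (trans (FinP.toℕ-inject j) (FinP.toℕ-fromℕ< b<a)))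
                        (proj₂ (proj₂ smallest) j)
      where j : Fin′ b₀
            j = fromℕ< b<a
    above : ∀ b → a ≤ toℕ b → ¬ Below b
    above b a≤b b-below = proj₁ (proj₂ smallest) (≤-<-trans (h-mono b₀ b a≤b) b-below)
    0<a : 0 < a
    0<a with a in a≡
    ... | suc _ = z<s
    ... | zero with rank-surjective p' 0 (≤-<-trans z≤n a'<k')
    ...   | i , rank≡0 = ⊥-elim (above (Vec.lookup v i) (subst (_≤ toℕ (Vec.lookup v i)) (sym a≡) z≤n)
                                   (subst (_< a') (trans (sym rank≡0) (rank'≡ i)) 0<a'))
    cut'⊆cut : cut p' a' ⊆ cut p a
    cut'⊆cut {i} i∈ = ∈-cut⁺ p a i (≰⇒> λ a≤ → above (Vec.lookup v i) a≤
                                     (subst (_< a') (rank'≡ i) (∈-cut⁻ p' a' i i∈)))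
    cut⊆cut' : cut p a ⊆ cut p' a'
    cut⊆cut' {i} i∈ = ∈-cut⁺ p' a' i (subst (_< a') (sym (rank'≡ i))
                                       (below (Vec.lookup v i) (∈-cut⁻ p a i i∈)))

  -- Conversely, if every cut of p' is a cut of p then p' is a coarsening
  -- of p: elements strictly ordered by p' are strictly ordered by p, so the
  -- block map "block of p ↦ block of p' of any of its elements" is a
  -- well-defined monotone coarsening.
  cuts⇒⊑ : ∀ (p p' : OrderedPartition r) → (∀ S → IsCut p' S → IsCut p S) → _⊑_ (𝒫 r) p p'
  cuts⇒⊑ p@(k , v , surj) p'@(k' , v' , _) cuts'⊆cuts = h , h-mono , v'≡hv
    where
    separated : ∀ i j → rank p' i < rank p' j → rank p i < rank p j
    separated i j lt with cuts'⊆cuts (cut p' (suc (rank p' i)))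
                                    (suc (rank p' i) , z<s , ≤-<-trans lt (rank< p' j) , refl)
    ... | a , _ , _ , cut'≡cut = <-≤-trans i-below (≮⇒≥ j-not-below)
      where
      i-below : rank p i < a
      i-below = ∈-cut⁻ p a i (subst (i ∈_) cut'≡cut (∈-cut⁺ p' _ i (n<1+n _)))
      j-not-below : ¬ (rank p j < a)
      j-not-below j-below = <⇒≱ lt (s≤s⁻¹ (∈-cut⁻ p' _ j (subst (j ∈_) (sym cut'≡cut)
                                                            (∈-cut⁺ p a j j-below))))
    sameBlock : ∀ i j → rank p i ≡ rank p j → rank p' i ≡ rank p' j
    sameBlock i j eq with <-cmp (rank p' i) (rank p' j)
    ... | tri≈ _ eq' _ = eq'
    ... | tri< lt _ _ = ⊥-elim (<⇒≢ (separated i j lt) eq)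
    ... | tri> _ _ gt = ⊥-elim (<⇒≢ (separated j i gt) (sym eq))
    representative : Fin k → Fin r
    representative b = proj₁ (surj b)
    h : Fin k → Fin k'
    h b = Vec.lookup v' (representative b)
    rank-representative : ∀ b → rank p (representative b) ≡ toℕ b
    rank-representative b = cong toℕ (proj₂ (surj b))
    h-mono : ∀ a b → a F.≤ b → h a F.≤ h b
    h-mono a b a≤b = ≮⇒≥ λ hb<ha → <⇒≱ (subst₂< (separated (representative b) (representative a) hb<ha)) a≤b
      where subst₂< : rank p (representative b) < rank p (representative a) → toℕ b < toℕ a
            subst₂< lt rewrite rank-representative a | rank-representative b = lt
    v'≡hv : ∀ i → Vec.lookup v' i ≡ h (Vec.lookup v i)
    v'≡hv i = FinP.toℕ-injective
      (sameBlock i (representative (Vec.lookup v i)) (sym (rank-representative (Vec.lookup v i))))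

  -- If S is proper, comparable with every cut of p and
  -- not itself a cut, then S splits exactly one block b of p, and refining p
  -- by that split yields a partition whose cuts are those of p together
  -- with S.
  module InsertCut (p : OrderedPartition r) (S : Subset r) (S-proper : Proper S)
    (S-comparable : ∀ T → IsCut p T → Comparable S T) (S-new : ¬ IsCut p S) where

    k : ℕ
    k = blocks p

    -- b is the first block containing an element outside S.
    HasOutsider : Fin k → Set
    HasOutsider c = ∃[ i ] (rank p i ≡ toℕ c × i ∉ S)

    hasOutsider? : ∀ c → Dec (HasOutsider c)
    hasOutsider? c = FinP.any? (λ i → (rank p i ≟ℕ toℕ c) ×-dec ¬? (i ∈? S))

    smallest = FinP.¬∀⟶∃¬-smallest k (λ c → ¬ HasOutsider c) (λ c → ¬? (hasOutsider? c))
                 λ none → let (i , i∉S) = proj₂ S-proper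
                          in none (fromℕ< (rank< p i)) (i , sym (FinP.toℕ-fromℕ< _) , i∉S)

    b : ℕ
    b = toℕ (proj₁ smallest)

    b<k : b < k
    b<k = FinP.toℕ<n (proj₁ smallest)

    outsider : HasOutsider (proj₁ smallest)
    outsider with hasOutsider? (proj₁ smallest)
    ... | yes o = o
    ... | no ¬o = ⊥-elim (proj₁ (proj₂ smallest) ¬o)

    outside⇒b≤ : ∀ i → i ∉ S → b ≤ rank p i
    outside⇒b≤ i i∉S = ≮⇒≥ λ lt → proj₂ (proj₂ smallest) (fromℕ< lt)
      (i , sym (trans (FinP.toℕ-inject (fromℕ< lt)) (FinP.toℕ-fromℕ< lt)) , i∉S)

    <b⇒inside : ∀ i → rank p i < b → i ∈ S
    <b⇒inside i lt with i ∈? S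
    ... | yes i∈S = i∈S
    ... | no i∉S = ⊥-elim (<⇒≱ lt (outside⇒b≤ i i∉S))

    -- S does not reach beyond block b, since it is comparable with the cut
    -- below block b + 1, which contains an outsider.
    inside⇒≤b : ∀ i → i ∈ S → rank p i ≤ b
    inside⇒≤b i i∈S with suc b <? k
    ... | no b+1≮k = s≤s⁻¹ (≤-trans (rank< p i) (≮⇒≥ b+1≮k))
    ... | yes b+1<k with S-comparable (cut p (suc b)) (suc b , z<s , b+1<k , refl)
    ...   | inj₁ S⊆cut = s≤s⁻¹ (∈-cut⁻ p (suc b) i (S⊆cut i∈S))
    ...   | inj₂ cut⊆S = let (o , rank≡b , o∉S) = outsider
                         in ⊥-elim (o∉S (cut⊆S (∈-cut⁺ p (suc b) o (subst (_< suc b) (sym rank≡b) (n<1+n b)))))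

    -- S meets block b, for otherwise S would be the cut below block b.
    insider : ∃[ i ] (i ∈ S × rank p i ≡ b)
    insider with FinP.any? (λ i → (i ∈? S) ×-dec (rank p i ≟ℕ b))
    ... | yes w = w
    ... | no none = ⊥-elim (S-new (b , 0<b , b<k , ⊆-antisym S⊆cut cut⊆S))
      where
      inside⇒<b : ∀ i → i ∈ S → rank p i < b
      inside⇒<b i i∈S = ≤∧≢⇒< (inside⇒≤b i i∈S) (λ eq → none (i , i∈S , eq))
      0<b : 0 < b
      0<b = let (i , i∈S) = proj₁ S-proper in ≤-<-trans z≤n (inside⇒<b i i∈S)
      S⊆cut : S ⊆ cut p b
      S⊆cut {i} i∈S = ∈-cut⁺ p b i (inside⇒<b i i∈S)
      cut⊆S : cut p b ⊆ S
      cut⊆S {i} i∈cut = <b⇒inside i (∈-cut⁻ p b i i∈cut)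

    shift : ∀ i → Dec (i ∈ S) → ℕ
    shift i (yes _) = rank p i
    shift i (no _) = suc (rank p i)

    newRank : Fin r → ℕ
    newRank i = shift i (i ∈? S)

    newRank-inside : ∀ i → i ∈ S → newRank i ≡ rank p i
    newRank-inside i i∈S with i ∈? S
    ... | yes _ = refl
    ... | no i∉S = ⊥-elim (i∉S i∈S)

    newRank-outside : ∀ i → i ∉ S → newRank i ≡ suc (rank p i)
    newRank-outside i i∉S with i ∈? S
    ... | yes i∈S = ⊥-elim (i∉S i∈S)
    ... | no _ = refl

    newRank< : ∀ i → newRank i < suc k
    newRank< i with i ∈? S
    ... | yes _ = m<n⇒m<1+n (rank< p i)
    ... | no _ = s<s (rank< p i)

    newRank-onto : ∀ j → j < suc k → ∃[ i ] newRank i ≡ j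
    newRank-onto j j<k+1 with <-cmp j b
    ... | tri< j<b _ _ = let (i , rank≡j) = rank-surjective p j (<-trans j<b b<k)
                         in i , trans (newRank-inside i (<b⇒inside i (subst (_< b) (sym rank≡j) j<b))) rank≡j
    ... | tri≈ _ j≡b _ = let (i , i∈S , rank≡b) = insider
                         in i , trans (newRank-inside i i∈S) (trans rank≡b (sym j≡b))
    newRank-onto (suc c) c+1<k+1 | tri> _ _ b<c+1 with rank-surjective p c (s<s⁻¹ c+1<k+1)
    ... | i , rank≡c with i ∈? S
    ...   | no i∉S = i , trans (newRank-outside i i∉S) (cong suc rank≡c)
    ...   | yes i∈S = let (o , rank≡b , o∉S) = outsider
                      in o , trans (newRank-outside o o∉S)
                                   (cong suc (trans rank≡b (≤-antisym (s≤s⁻¹ b<c+1)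
                                                             (subst (_≤ b) rank≡c (inside⇒≤b i i∈S)))))

    refined : OrderedPartition r
    refined = fromRank (suc k) newRank newRank< newRank-onto

    ∈-refinedCut⁺ : ∀ a i → newRank i < a → i ∈ cut refined a
    ∈-refinedCut⁺ a i lt =
      ∈-cut⁺ refined a i (subst (_< a) (sym (rank-fromRank (suc k) newRank newRank< newRank-onto i)) lt)

    ∈-refinedCut⁻ : ∀ a i → i ∈ cut refined a → newRank i < a
    ∈-refinedCut⁻ a i i∈ =
      subst (_< a) (rank-fromRank (suc k) newRank newRank< newRank-onto i) (∈-cut⁻ refined a i i∈)

    lowCut : ∀ a → a ≤ b → cut refined a ≡ cut p a
    lowCut a a≤b = ⊆-antisym ⊆old old⊆
      where
      ⊆old : cut refined a ⊆ cut p a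
      ⊆old {i} i∈ with i ∈? S
      ... | yes i∈S = ∈-cut⁺ p a i (subst (_< a) (newRank-inside i i∈S) (∈-refinedCut⁻ a i i∈))
      ... | no i∉S = ⊥-elim (<⇒≱ (∈-refinedCut⁻ a i i∈)
                      (subst (a ≤_) (sym (newRank-outside i i∉S)) (m≤n⇒m≤1+n (≤-trans a≤b (outside⇒b≤ i i∉S)))))
      old⊆ : cut p a ⊆ cut refined a
      old⊆ {i} i∈ with i ∈? S
      ... | yes i∈S = ∈-refinedCut⁺ a i (subst (_< a) (sym (newRank-inside i i∈S)) (∈-cut⁻ p a i i∈))
      ... | no i∉S = ⊥-elim (<⇒≱ (∈-cut⁻ p a i i∈) (≤-trans a≤b (outside⇒b≤ i i∉S)))

    splitCut : cut refined (suc b) ≡ S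
    splitCut = ⊆-antisym ⊆S S⊆
      where
      ⊆S : cut refined (suc b) ⊆ S
      ⊆S {i} i∈ with i ∈? S
      ... | yes i∈S = i∈S
      ... | no i∉S = ⊥-elim (<⇒≱ (∈-refinedCut⁻ (suc b) i i∈)
                      (subst (suc b ≤_) (sym (newRank-outside i i∉S)) (s≤s (outside⇒b≤ i i∉S))))
      S⊆ : S ⊆ cut refined (suc b)
      S⊆ {i} i∈S = ∈-refinedCut⁺ (suc b) i (subst (_< suc b) (sym (newRank-inside i i∈S)) (s≤s (inside⇒≤b i i∈S)))

    highCut : ∀ c → b < c → cut refined (suc c) ≡ cut p c
    highCut c b<c = ⊆-antisym ⊆old old⊆
      where
      ⊆old : cut refined (suc c) ⊆ cut p c
      ⊆old {i} i∈ with i ∈? S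
      ... | yes i∈S = ∈-cut⁺ p c i (≤-<-trans (inside⇒≤b i i∈S) b<c)
      ... | no i∉S = ∈-cut⁺ p c i (s<s⁻¹ (subst (_< suc c) (newRank-outside i i∉S) (∈-refinedCut⁻ (suc c) i i∈)))
      old⊆ : cut p c ⊆ cut refined (suc c)
      old⊆ {i} i∈ with i ∈? S
      ... | yes i∈S = ∈-refinedCut⁺ (suc c) i
                        (subst (_< suc c) (sym (newRank-inside i i∈S)) (s≤s (≤-trans (inside⇒≤b i i∈S) (<⇒≤ b<c))))
      ... | no i∉S = ∈-refinedCut⁺ (suc c) i (subst (_< suc c) (sym (newRank-outside i i∉S)) (s<s (∈-cut⁻ p c i i∈)))

    refinedCut⇒ : ∀ T → IsCut refined T → T ≡ S ⊎ IsCut p T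
    refinedCut⇒ T (a , 0<a , a<k+1 , refl) with <-cmp a (suc b)
    ... | tri< a<b+1 _ _ = inj₂ (a , 0<a , ≤-<-trans (s≤s⁻¹ a<b+1) b<k , lowCut a (s≤s⁻¹ a<b+1))
    ... | tri≈ _ refl _ = inj₁ splitCut
    refinedCut⇒ T (suc c , 0<a , a<k+1 , refl) | tri> _ _ b+1<c+1 =
      inj₂ (c , ≤-<-trans z≤n (s<s⁻¹ b+1<c+1) , s<s⁻¹ a<k+1 , highCut c (s<s⁻¹ b+1<c+1))

    refinedCut⇐ : ∀ T → T ≡ S ⊎ IsCut p T → IsCut refined T
    refinedCut⇐ T (inj₁ refl) = suc b , z<s , s<s b<k , sym splitCut
    refinedCut⇐ T (inj₂ (a , 0<a , a<k , refl)) with a ≤? b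
    ... | yes a≤b = a , 0<a , m<n⇒m<1+n a<k , sym (lowCut a a≤b)
    ... | no a≰b = suc a , z<s , s<s a<k , sym (highCut a (≰⇒> a≰b))

  -- Every finite chain of proper subsets of Fin r (r > 0) is exactly the
  -- cut set of some ordered partition: insert the members one at a time
  -- into the one-block partition.
  chain⇒partition : 0 < r → (L : List (Subset r)) → (∀ S → S LM.∈ L → Proper S) →
    (∀ S T → S LM.∈ L → T LM.∈ L → Comparable S T) →
    Σ (OrderedPartition r) λ p → ∀ S → (IsCut p S → S LM.∈ L) × (S LM.∈ L → IsCut p S)
  chain⇒partition 0<r [] _ _ = oneBlock , λ S → noCut S , λ ()
    where
    oneBlock : OrderedPartition r
    oneBlock = fromRank 1 (λ _ → 0) (λ _ → z<s) (λ { zero _ → fromℕ< 0<r , refl ; (suc j) (s≤s ()) })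
    noCut : ∀ S → IsCut oneBlock S → S LM.∈ []
    noCut S (a , 0<a , a<1 , _) = ⊥-elim (<⇒≱ 0<a (s≤s⁻¹ a<1))
  chain⇒partition 0<r (S ∷ L) proper comparable
    with chain⇒partition 0<r L (λ T T∈ → proper T (Any.there T∈))
                                (λ T U T∈ U∈ → comparable T U (Any.there T∈) (Any.there U∈))
  ... | p , cuts-p with S ∈L? L
    where open DecMembership (_≟ₛ_ {r}) renaming (_∈?_ to _∈L?_)
  ... | yes S∈L = p , λ T → (λ T-cut → Any.there (proj₁ (cuts-p T) T-cut)) ,
                           (λ { (Any.here refl) → proj₂ (cuts-p T) S∈L ; (Any.there T∈) → proj₂ (cuts-p T) T∈ })
  ... | no S∉L = InsertCut.refined p S S-proper S-comparable S-new ,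
                 λ T → (λ T-cut → cut∈ T (InsertCut.refinedCut⇒ p S S-proper S-comparable S-new T T-cut)) ,
                       (λ { (Any.here refl) → InsertCut.refinedCut⇐ p S S-proper S-comparable S-new T (inj₁ refl)
                          ; (Any.there T∈) → InsertCut.refinedCut⇐ p S S-proper S-comparable S-new T
                                           (inj₂ (proj₂ (cuts-p T) T∈)) })
    where
    S-proper : Proper S
    S-proper = proper S (Any.here refl)
    S-comparable : ∀ T → IsCut p T → Comparable S T
    S-comparable T T-cut = comparable S T (Any.here refl) (Any.there (proj₁ (cuts-p T) T-cut))
    S-new : ¬ IsCut p S
    S-new S-cut = S∉L (proj₁ (cuts-p S) S-cut)
    cut∈ : ∀ T → T ≡ S ⊎ IsCut p T → T LM.∈ (S ∷ L)
    cut∈ T (inj₁ T≡S) = Any.here T≡S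
    cut∈ T (inj₂ T-cut) = Any.there (proj₁ (cuts-p T) T-cut)

does-sound : ∀ {P : Set} (d : Dec P) → T (does d) → P
does-sound (yes p) _ = p

-- Two edges are parallel when their end pairs agree up to orientation;
-- `Joins G e x y` is literally `SameBundle (ends G e) (x , y)`.
module _ {n : ℕ} where

  SameBundle : Fin n × Fin n → Fin n × Fin n → Set
  SameBundle a b = (a ≡ b) ⊎ (a ≡ swap b)

  sameBundle-sym : ∀ {a b} → SameBundle a b → SameBundle b a
  sameBundle-sym (inj₁ refl) = inj₁ refl
  sameBundle-sym {a = x , y} (inj₂ refl) = inj₂ refl

  sameBundle-trans : ∀ {a b c} → SameBundle a b → SameBundle b c → SameBundle a c
  sameBundle-trans (inj₁ refl) b∼c = b∼c
  sameBundle-trans (inj₂ refl) (inj₁ refl) = inj₂ refl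
  sameBundle-trans {c = x , y} (inj₂ refl) (inj₂ refl) = inj₁ refl

  NonLoop : Fin n × Fin n → Set
  NonLoop a = proj₁ a ≢ proj₂ a

  sameBundle-nonloop : ∀ {a b} → SameBundle a b → NonLoop b → NonLoop a
  sameBundle-nonloop (inj₁ refl) nonloop = nonloop
  sameBundle-nonloop (inj₂ refl) nonloop = nonloop ∘ sym

  sameBundle-ends : ∀ (N : Subset n) {a x y} → SameBundle a (x , y) → x ∈ N → y ∈ N →
                    proj₁ a ∈ N × proj₂ a ∈ N
  sameBundle-ends N (inj₁ refl) x∈ y∈ = x∈ , y∈
  sameBundle-ends N (inj₂ refl) x∈ y∈ = y∈ , x∈

  -- The Boolean bundle test in the definition of G_s is a decision
  -- procedure for SameBundle, written componentwise.
  SameBundleᶜ : Fin n × Fin n → Fin n × Fin n → Set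
  SameBundleᶜ a b = (proj₁ a ≡ proj₁ b × proj₂ a ≡ proj₂ b) ⊎ (proj₁ a ≡ proj₂ b × proj₂ a ≡ proj₁ b)

  sameBundle? : ∀ a b → Dec (SameBundleᶜ a b)
  sameBundle? (x , y) (x' , y') = ((x ≟ x') ×-dec (y ≟ y')) ⊎-dec ((x ≟ y') ×-dec (y ≟ x'))

  fromComponents : ∀ {a b} → SameBundleᶜ a b → SameBundle a b
  fromComponents (inj₁ (refl , refl)) = inj₁ refl
  fromComponents (inj₂ (refl , refl)) = inj₂ refl

  toComponents : ∀ {a b} → SameBundle a b → SameBundleᶜ a b
  toComponents (inj₁ refl) = inj₁ (refl , refl)
  toComponents (inj₂ refl) = inj₂ (refl , refl)

module Kept {n : ℕ} (G : Pseudograph n) where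

  Kept : Edge G → Set
  Kept e = keepᵇ G e ≡ true

  EarlierInBundle : Edge G → Edge G → Set
  EarlierInBundle e j = toℕ j < toℕ e × SameBundle (ends G j) (ends G e)

  -- Its Boolean value is exactly the test applied to j in keepᵇ G e.
  earlierInBundle? : ∀ e j → Dec (toℕ j < toℕ e × SameBundleᶜ (ends G j) (ends G e))
  earlierInBundle? e j = (toℕ j <? toℕ e) ×-dec sameBundle? (ends G j) (ends G e)

  kept-nonloop : ∀ e → Kept e → NonLoop (ends G e)
  kept-nonloop e kept loop with proj₁ (ends G e) ≟ proj₂ (ends G e)
  kept-nonloop e () loop | yes _
  ... | no notLoop = notLoop loop

  kept-first : ∀ e → Kept e → ∀ j → ¬ EarlierInBundle e j
  kept-first e kept j (j<e , j∼e) = true≢false (trans (sym kept) keep≡false)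
    where
    true≢false : true ≢ false
    true≢false ()
    hasEarlier : any (does ∘ earlierInBundle? e) (allFin (length G)) ≡ true
    hasEarlier = Equivalence.to T-≡ (any⁺ _ (lose (∈-allFin j)
                   (Equivalence.from T-≡ (dec-true (earlierInBundle? e j) (j<e , toComponents j∼e)))))
    keep≡false : keepᵇ G e ≡ false
    keep≡false = trans (cong (λ b → not (does (proj₁ (ends G e) ≟ proj₂ (ends G e))) ∧ not b) hasEarlier) (∧-zeroʳ _)

  unkept-earlier : ∀ e → keepᵇ G e ≡ false → NonLoop (ends G e) → ∃[ j ] EarlierInBundle e j
  unkept-earlier e unkept nonloop
    with proj₁ (ends G e) ≟ proj₂ (ends G e) | any (does ∘ earlierInBundle? e) (allFin (length G)) in hasEarlier
  ... | yes loop | _ = ⊥-elim (nonloop loop)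
  ... | no _ | true with Any.satisfied (any⁻ _ (allFin (length G)) (Equivalence.from T-≡ hasEarlier))
  ...   | j , earlier with does-sound (earlierInBundle? e j) earlier
  ...     | j<e , j∼e = j , j<e , fromComponents j∼e

  -- Two parallel kept edges coincide: neither can precede the other.
  kept-unique : ∀ e e' → Kept e → Kept e' → SameBundle (ends G e') (ends G e) → e ≡ e'
  kept-unique e e' kept kept' e'∼e with <-cmp (toℕ e') (toℕ e)
  ... | tri≈ _ eq _ = FinP.toℕ-injective (sym eq)
  ... | tri< e'<e _ _ = ⊥-elim (kept-first e kept e' (e'<e , e'∼e))
  ... | tri> _ _ e<e' = ⊥-elim (kept-first e' kept' e (e<e' , sameBundle-sym e'∼e))

  -- Following earlier parallel edges terminates at a kept edge.
  representative : ∀ e → NonLoop (ends G e) → ∃[ f ] (Kept f × SameBundle (ends G f) (ends G e))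
  representative e = search (suc (toℕ e)) e (n<1+n _)
    where
    search : ∀ N e → toℕ e < N → NonLoop (ends G e) → ∃[ f ] (Kept f × SameBundle (ends G f) (ends G e))
    search (suc N) e e<N nonloop with keepᵇ G e in keep
    ... | true = e , keep , inj₁ refl
    ... | false with unkept-earlier e keep nonloop
    ...   | j , j<e , j∼e with search N j (<-≤-trans j<e (s≤s⁻¹ e<N)) (sameBundle-nonloop j∼e nonloop)
    ...     | f , kept-f , f∼j = f , kept-f , sameBundle-trans f∼j j∼e

enum : ∀ {m} (p : Subset m) → Fin ∣ p ∣ → Fin m
enum (inside ∷ p) F.zero = F.zero
enum (inside ∷ p) (F.suc i) = F.suc (enum p i)
enum (outside ∷ p) i = F.suc (enum p i)

enum-∈ : ∀ {m} (p : Subset m) i → enum p i ∈ p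
enum-∈ (inside ∷ p) F.zero = here
enum-∈ (inside ∷ p) (F.suc i) = there (enum-∈ p i)
enum-∈ (outside ∷ p) i = there (enum-∈ p i)

enum-injective : ∀ {m} (p : Subset m) {i j} → enum p i ≡ enum p j → i ≡ j
enum-injective (inside ∷ p) {F.zero} {F.zero} _ = refl
enum-injective (inside ∷ p) {F.suc i} {F.suc j} eq = cong F.suc (enum-injective p (FinP.suc-injective eq))
enum-injective (outside ∷ p) eq = enum-injective p (FinP.suc-injective eq)

index : ∀ {m} (p : Subset m) (x : Fin m) → x ∈ p → Fin ∣ p ∣
index (inside ∷ p) F.zero _ = F.zero
index (inside ∷ p) (F.suc x) (there x∈p) = F.suc (index p x x∈p)
index (outside ∷ p) (F.suc x) (there x∈p) = index p x x∈p

enum-index : ∀ {m} (p : Subset m) x (x∈p : x ∈ p) → enum p (index p x x∈p) ≡ x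
enum-index (inside ∷ p) F.zero here = refl
enum-index (inside ∷ p) (F.suc x) (there x∈p) = cong F.suc (enum-index p x x∈p)
enum-index (outside ∷ p) (F.suc x) (there x∈p) = cong F.suc (enum-index p x x∈p)

-- They form a minimum set
-- whose removal leaves a simple graph: removing them works, and any set R
-- that works receives an injection from them (a redundant edge outside R is
-- charged to its kept representative, which must then lie in R).
module Redundant {n : ℕ} (G : Pseudograph n) where
  open Kept G

  redundant : Subset (length G)
  redundant = Vec.tabulate (not ∘ keepᵇ G)

  ∈-redundant⁺ : ∀ e → keepᵇ G e ≡ false → e ∈ redundant
  ∈-redundant⁺ e unkept = ∈-tabulate⁺ _ e (cong not unkept)

  ∈-redundant⁻ : ∀ e → e ∈ redundant → keepᵇ G e ≡ false
  ∈-redundant⁻ e e∈ = not-injective (∈-tabulate⁻ _ e e∈)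

  kept⇒∉redundant : ∀ e → Kept e → e ∉ redundant
  kept⇒∉redundant e kept e∈ with trans (sym kept) (∈-redundant⁻ e e∈)
  ... | ()

  ∉redundant⇒kept : ∀ e → e ∉ redundant → Kept e
  ∉redundant⇒kept e e∉ with keepᵇ G e in keep
  ... | true = refl
  ... | false = ⊥-elim (e∉ (∈-redundant⁺ e keep))

  redundant-simple : SimpleAfterRemoving G redundant
  redundant-simple =
    (λ e e∉ → kept-nonloop e (∉redundant⇒kept e e∉)) ,
    (λ e e' e∉ e'∉ e≢e' e'∼e → e≢e' (kept-unique e e' (∉redundant⇒kept e e∉) (∉redundant⇒kept e' e'∉) e'∼e))

  module Charge (R : Subset (length G)) (R-simple : SimpleAfterRemoving G R) where

    charge : (e : Edge G) → Dec (e ∈ R) → Edge G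
    charge e (yes _) = e
    charge e (no e∉R) = proj₁ (representative e (proj₁ R-simple e e∉R))

    -- The charge lies in R: otherwise two distinct parallel edges survive.
    charge-∈R : ∀ e → e ∈ redundant → (d : Dec (e ∈ R)) → charge e d ∈ R
    charge-∈R e e∈ (yes e∈R) = e∈R
    charge-∈R e e∈ (no e∉R) with representative e (proj₁ R-simple e e∉R)
    ... | f , kept-f , f∼e with f ∈? R
    ...   | yes f∈R = f∈R
    ...   | no f∉R = ⊥-elim (proj₂ R-simple e f e∉R f∉R e≢f f∼e)
      where e≢f : e ≢ f
            e≢f refl = kept⇒∉redundant e kept-f e∈

    -- Distinct redundant edges get distinct charges: a kept charge is not
    -- redundant, and two edges outside R sharing a representative are parallel.
    charge-injective : ∀ e₁ e₂ → e₁ ∈ redundant → e₂ ∈ redundant →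
      (d₁ : Dec (e₁ ∈ R)) (d₂ : Dec (e₂ ∈ R)) → charge e₁ d₁ ≡ charge e₂ d₂ → e₁ ≡ e₂
    charge-injective e₁ e₂ _ _ (yes _) (yes _) eq = eq
    charge-injective e₁ e₂ e₁∈ _ (yes _) (no e₂∉R) refl =
      ⊥-elim (kept⇒∉redundant e₁ (proj₁ (proj₂ (representative e₂ (proj₁ R-simple e₂ e₂∉R)))) e₁∈)
    charge-injective e₁ e₂ _ e₂∈ (no e₁∉R) (yes _) refl =
      ⊥-elim (kept⇒∉redundant e₂ (proj₁ (proj₂ (representative e₁ (proj₁ R-simple e₁ e₁∉R)))) e₂∈)
    charge-injective e₁ e₂ _ _ (no e₁∉R) (no e₂∉R) eq with e₁ ≟ e₂
    ... | yes e₁≡e₂ = e₁≡e₂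
    ... | no e₁≢e₂ = ⊥-elim (proj₂ R-simple e₁ e₂ e₁∉R e₂∉R e₁≢e₂
                              (sameBundle-trans (sameBundle-sym f∼e₂)
                                 (subst (λ f → SameBundle (ends G f) (ends G e₁)) eq f∼e₁)))
      where f∼e₁ = proj₂ (proj₂ (representative e₁ (proj₁ R-simple e₁ e₁∉R)))
            f∼e₂ = proj₂ (proj₂ (representative e₂ (proj₁ R-simple e₂ e₂∉R)))

    chargeIndex : Fin ∣ redundant ∣ → Fin ∣ R ∣
    chargeIndex i = index R (charge (enum redundant i) (enum redundant i ∈? R))
                            (charge-∈R _ (enum-∈ redundant i) (enum redundant i ∈? R))

    chargeIndex-injective : ∀ {i j} → chargeIndex i ≡ chargeIndex j → i ≡ j
    chargeIndex-injective {i} {j} eq = enum-injective redundant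
      (charge-injective _ _ (enum-∈ redundant i) (enum-∈ redundant j) (enum redundant i ∈? R) (enum redundant j ∈? R)
        (trans (sym (enum-index R _ _)) (trans (cong (enum R) eq) (enum-index R _ _))))

  redundant-minimal : ∀ R → SimpleAfterRemoving G R → ∣ redundant ∣ ≤ ∣ R ∣
  redundant-minimal R R-simple = FinP.injective⇒≤ (Charge.chargeIndex-injective R R-simple)

  redundant-count : ∀ r → RedundantCount G r → ∣ redundant ∣ ≡ r
  redundant-count r ((R , R-simple , ∣R∣≡r) , r-minimal) =
    ≤-antisym (subst (∣ redundant ∣ ≤_) ∣R∣≡r (redundant-minimal R R-simple)) (r-minimal redundant redundant-simple)

module Positions {A B : Set} (f : A → B) where

  origin : (xs : List A) → Fin (length (map f xs)) → A
  origin (x ∷ xs) F.zero = x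
  origin (x ∷ xs) (F.suc i) = origin xs i

  lookup-map : ∀ xs i → lookup (map f xs) i ≡ f (origin xs i)
  lookup-map (x ∷ xs) F.zero = refl
  lookup-map (x ∷ xs) (F.suc i) = lookup-map xs i

  origin-∈ : ∀ xs i → origin xs i LM.∈ xs
  origin-∈ (x ∷ xs) F.zero = Any.here refl
  origin-∈ (x ∷ xs) (F.suc i) = Any.there (origin-∈ xs i)

  origin-surjective : ∀ xs x → x LM.∈ xs → ∃[ i ] origin xs i ≡ x
  origin-surjective (y ∷ xs) x (Any.here refl) = F.zero , refl
  origin-surjective (y ∷ xs) x (Any.there x∈) with origin-surjective xs x x∈
  ... | i , eq = F.suc i , eq

  origin-injective : ∀ xs → Unique xs → ∀ i j → origin xs i ≡ origin xs j → i ≡ j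
  origin-injective (x ∷ xs) _ F.zero F.zero _ = refl
  origin-injective (x ∷ xs) (x∉ AllPairs.∷ _) F.zero (F.suc j) eq = ⊥-elim (All.lookup x∉ (origin-∈ xs j) eq)
  origin-injective (x ∷ xs) (x∉ AllPairs.∷ _) (F.suc i) F.zero eq = ⊥-elim (All.lookup x∉ (origin-∈ xs i) (sym eq))
  origin-injective (x ∷ xs) (_ AllPairs.∷ unique) (F.suc i) (F.suc j) eq = cong F.suc (origin-injective xs unique i j eq)

-- Every walk of G can be
-- rerouted through kept edges, so G_s is spanning and connected when G is.
module Underlying {n : ℕ} (G : Pseudograph n) where
  open Kept G public
  open Positions (ends G)

  Gs : Pseudograph n
  Gs = underlying G

  keptEdges : List (Edge G)
  keptEdges = filterᵇ (keepᵇ G) (allFin (length G))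

  ∈-keptEdges⁺ : ∀ e → Kept e → e LM.∈ keptEdges
  ∈-keptEdges⁺ e kept = ∈-filter⁺ (T? ∘ keepᵇ G) (∈-allFin e) (Equivalence.from T-≡ kept)

  ∈-keptEdges⁻ : ∀ e → e LM.∈ keptEdges → Kept e
  ∈-keptEdges⁻ e e∈ = Equivalence.to T-≡ (proj₂ (∈-filter⁻ (T? ∘ keepᵇ G) {xs = allFin (length G)} e∈))

  ι : Edge Gs → Edge G
  ι = origin keptEdges

  ι-ends : ∀ e' → ends Gs e' ≡ ends G (ι e')
  ι-ends = lookup-map keptEdges

  ι-kept : ∀ e' → Kept (ι e')
  ι-kept e' = ∈-keptEdges⁻ _ (origin-∈ keptEdges e')

  ι-surjective : ∀ e → Kept e → ∃[ e' ] ι e' ≡ e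
  ι-surjective e kept = origin-surjective keptEdges e (∈-keptEdges⁺ e kept)

  ι-injective : ∀ i j → ι i ≡ ι j → i ≡ j
  ι-injective = origin-injective keptEdges (Unique.filter⁺ (T? ∘ keepᵇ G) (Unique.allFin⁺ (length G)))

  Gs-nonloop : ∀ e' → NonLoop (ends Gs e')
  Gs-nonloop e' = subst NonLoop (sym (ι-ends e')) (kept-nonloop _ (ι-kept e'))

  Gs-simple : ∀ e₁ e₂ → SameBundle (ends Gs e₂) (ends Gs e₁) → e₁ ≡ e₂
  Gs-simple e₁ e₂ e₂∼e₁ = ι-injective e₁ e₂
    (kept-unique (ι e₁) (ι e₂) (ι-kept e₁) (ι-kept e₂) (subst₂ (ι-ends e₂) (ι-ends e₁) e₂∼e₁))
    where subst₂ : ∀ {a a' c c'} → a ≡ a' → c ≡ c' → SameBundle a c → SameBundle a' c'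
          subst₂ refl refl a∼c = a∼c

  K : Subset (length G)
  K = proj₂ (underlyingTube G)

  ∈K⁺ : ∀ e → Kept e → e ∈ K
  ∈K⁺ e kept = ∈-tabulate⁺ _ e (if-true kept)
    where if-true : ∀ {b} → b ≡ true → (if b then inside else outside) ≡ true
          if-true refl = refl

  ∈K⁻ : ∀ e → e ∈ K → Kept e
  ∈K⁻ e e∈K = if-true (∈-tabulate⁻ _ e e∈K)
    where if-true : ∀ {b} → (if b then inside else outside) ≡ true → b ≡ true
          if-true {true} _ = refl

  walk-mono : ∀ {E E' : Subset (length G)} {x y} → E ⊆ E' → Walk G E x y → Walk G E' x y
  walk-mono E⊆E' here = here
  walk-mono E⊆E' (step e e∈E joins w) = step e (E⊆E' e∈E) joins (walk-mono E⊆E' w)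

  -- Drop loops and replace every other edge by its kept representative.
  walk-viaKept : ∀ {x y} → Walk G ⊤ x y → Walk G K x y
  walk-viaKept here = here
  walk-viaKept {x} (step {y = y} e _ joins w) with x ≟ y
  ... | yes refl = walk-viaKept w
  ... | no x≢y with representative e (sameBundle-nonloop joins x≢y)
  ...   | f , kept-f , f∼e = step f (∈K⁺ f kept-f) (sameBundle-trans f∼e joins) (walk-viaKept w)

module _ {n : ℕ} (H : Pseudograph n) where

  EndsIn : Subset n → Edge H → Set
  EndsIn N e = proj₁ (ends H e) ∈ N × proj₂ (ends H e) ∈ N

  endsIn? : ∀ N e → Dec (EndsIn N e)
  endsIn? N e = (proj₁ (ends H e) ∈? N) ×-dec (proj₂ (ends H e) ∈? N)

  induced : Subset n → Subset (length H)
  induced N = subsetOf (endsIn? N)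

  ∈-induced⁺ : ∀ N {e} → EndsIn N e → e ∈ induced N
  ∈-induced⁺ N = ∈-subsetOf⁺ (endsIn? N)

  ∈-induced⁻ : ∀ N {e} → e ∈ induced N → EndsIn N e
  ∈-induced⁻ N = ∈-subsetOf⁻ (endsIn? N)

  induced-mono : ∀ {N N'} → N ⊆ N' → induced N ⊆ induced N'
  induced-mono {N} {N'} N⊆N' e∈ = let (x∈ , y∈) = ∈-induced⁻ N e∈ in ∈-induced⁺ N' (N⊆N' x∈ , N⊆N' y∈)

  induced-⊤ : induced ⊤ ≡ ⊤
  induced-⊤ = ⊆-antisym (λ _ → ∈⊤) (λ _ → ∈-induced⁺ ⊤ (∈⊤ , ∈⊤))

compatible-subst : ∀ {n} (H : Pseudograph n) {a b c d} → a ≡ b → c ≡ d → Compatible H a c → Compatible H b d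
compatible-subst H refl refl compat = compat

-- Both
-- kinds of tube are determined by their node set N: a tube of G_s has all
-- edges of G_s inside N, and a tube of G inside G_s has all kept edges of
-- G inside N.
module Subtubes {n : ℕ} (G : Pseudograph n) where
  open Underlying G

  u : Sub G
  u = underlyingTube G

  toGs : Sub G → Sub Gs
  toGs (N , _) = N , induced Gs N

  fromGs : Sub Gs → Sub G
  fromGs (N , _) = N , K ∩ induced G N

  ∈-keptInduced⁺ : ∀ N e → Kept e → EndsIn G N e → e ∈ K ∩ induced G N
  ∈-keptInduced⁺ N e kept endsIn = x∈p∩q⁺ (∈K⁺ e kept , ∈-induced⁺ G N endsIn)

  ∈-keptInduced⁻ : ∀ N e → e ∈ K ∩ induced G N → Kept e × EndsIn G N e
  ∈-keptInduced⁻ N e e∈ = let (e∈K , e∈N) = x∈p∩q⁻ K (induced G N) e∈ in ∈K⁻ e e∈K , ∈-induced⁻ G N e∈N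

  keptInduced-⊤ : K ∩ induced G ⊤ ≡ K
  keptInduced-⊤ = trans (cong (K ∩_) (induced-⊤ G)) (∩-identityʳ K)

  keptInduced-mono : ∀ {N N'} → N ⊆ N' → K ∩ induced G N ⊆ K ∩ induced G N'
  keptInduced-mono {N} {N'} N⊆N' {e} e∈ = let (kept , x∈ , y∈) = ∈-keptInduced⁻ N e e∈
                                           in ∈-keptInduced⁺ N' e kept (N⊆N' x∈ , N⊆N' y∈)

  -- A tube contains, for each adjacent pair of its nodes, the unique edge of
  -- a simple graph joining them; so it is the induced subgraph on its nodes.
  tubeBelow-form : ∀ t → IsTube G t → _⊂ₛ_ G t u → t ≡ fromGs (toGs t)
  tubeBelow-form (N , E) (subgraph , _ , _ , closed) ((_ , E⊆K) , _) = cong (N ,_) (⊆-antisym E⊆ ⊆E)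
    where
    E⊆ : E ⊆ K ∩ induced G N
    E⊆ {e} e∈E = ∈-keptInduced⁺ N e (∈K⁻ e (E⊆K e∈E)) (subgraph e e∈E)
    ⊆E : K ∩ induced G N ⊆ E
    ⊆E {e} e∈ with ∈-keptInduced⁻ N e e∈
    ... | kept , x∈ , y∈ with closed _ _ x∈ y∈ (kept-nonloop e kept) (e , inj₁ refl)
    ...   | e' , e'∈E , e'∼e = subst (_∈ E) (sym (kept-unique e e' kept (∈K⁻ e' (E⊆K e'∈E)) e'∼e)) e'∈E

  tubeGs-form : ∀ s → IsTube Gs s → s ≡ toGs (fromGs s)
  tubeGs-form (N , E') (subgraph , _ , _ , closed) = cong (N ,_) (⊆-antisym E'⊆ ⊆E')
    where
    E'⊆ : E' ⊆ induced Gs N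
    E'⊆ {e} e∈E' = ∈-induced⁺ Gs N (subgraph e e∈E')
    ⊆E' : induced Gs N ⊆ E'
    ⊆E' {e} e∈ with ∈-induced⁻ Gs N e∈
    ... | x∈ , y∈ with closed _ _ x∈ y∈ (Gs-nonloop e) (e , inj₁ refl)
    ...   | e' , e'∈E' , e'∼e = subst (_∈ E') (sym (Gs-simple e e' e'∼e)) e'∈E'

  tubeGs-nodes≢⊤ : ∀ s → IsTube Gs s → proj₁ s ≢ ⊤
  tubeGs-nodes≢⊤ (N , E') tube@(_ , _ , proper , _) refl =
    proper (trans (tubeGs-form (⊤ , E') tube) (cong (⊤ ,_) (induced-⊤ Gs)))

  tubeBelow-nodes≢⊤ : ∀ t → IsTube G t → _⊂ₛ_ G t u → proj₁ t ≢ ⊤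
  tubeBelow-nodes≢⊤ (N , E) tube below@(_ , t≢u) refl =
    t≢u (trans (tubeBelow-form (⊤ , E) tube below) (cong (⊤ ,_) keptInduced-⊤))

  walk-toGs : ∀ N (E : Subset (length G)) → E ⊆ K → (∀ e → e ∈ E → EndsIn G N e) →
              ∀ {x y} → Walk G E x y → Walk Gs (induced Gs N) x y
  walk-toGs N E E⊆K inN here = here
  walk-toGs N E E⊆K inN (step e e∈E joins w) with ι-surjective e (∈K⁻ e (E⊆K e∈E))
  ... | e' , refl = step e' (∈-induced⁺ Gs N (subst (λ a → proj₁ a ∈ N × proj₂ a ∈ N) (sym (ι-ends e')) (inN _ e∈E)))
                         (subst (λ a → SameBundle a _) (sym (ι-ends e')) joins) (walk-toGs N E E⊆K inN w)

  walk-fromGs : ∀ N (E' : Subset (length Gs)) → (∀ e → e ∈ E' → EndsIn Gs N e) →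
                ∀ {x y} → Walk Gs E' x y → Walk G (K ∩ induced G N) x y
  walk-fromGs N E' inN here = here
  walk-fromGs N E' inN (step e' e'∈E' joins w) =
    step (ι e') (∈-keptInduced⁺ N (ι e') (ι-kept e')
                   (subst (λ a → proj₁ a ∈ N × proj₂ a ∈ N) (ι-ends e') (inN _ e'∈E')))
         (subst (λ a → SameBundle a _) (ι-ends e') joins) (walk-fromGs N E' inN w)

  toGs-tube : ∀ t → IsTube G t → _⊂ₛ_ G t u → IsTube Gs (toGs t)
  toGs-tube t@(N , E) tube@(subgraph , (x , walks) , _ , _) below@((_ , E⊆K) , _) =
    (λ e → ∈-induced⁻ Gs N) ,
    (x , λ a b a∈ b∈ → walk-toGs N E E⊆K subgraph (walks a b a∈ b∈)) ,
    (λ eq → tubeBelow-nodes≢⊤ t tube below (cong proj₁ eq)) ,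
    (λ a b a∈ b∈ _ (e' , joins) → e' , ∈-induced⁺ Gs N (sameBundle-ends N joins a∈ b∈) , joins)

  fromGs-tube : ∀ s → IsTube Gs s → IsTube G (fromGs s)
  fromGs-tube s@(N , E') tube@(subgraph , (x , walks) , _ , _) =
    (λ e e∈ → proj₂ (∈-keptInduced⁻ N e e∈)) ,
    (x , λ a b a∈ b∈ → walk-fromGs N E' subgraph (walks a b a∈ b∈)) ,
    (λ eq → tubeGs-nodes≢⊤ s tube (cong proj₁ eq)) ,
    closed
    where
    closed : ∀ a b → a ∈ N → b ∈ N → a ≢ b → ∃[ e ] Joins G e a b →
             ∃[ e ] (e ∈ K ∩ induced G N × Joins G e a b)
    closed a b a∈ b∈ a≢b (e , joins) with representative e (sameBundle-nonloop joins a≢b)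
    ... | f , kept-f , f∼e = f , ∈-keptInduced⁺ N f kept-f (sameBundle-ends N f∼ab a∈ b∈) , f∼ab
      where f∼ab = sameBundle-trans f∼e joins

  fromGs-below : ∀ s → IsTube Gs s → _⊂ₛ_ G (fromGs s) u
  fromGs-below s tube = ((λ _ → ∈⊤) , p∩q⊆p K _) , (λ eq → tubeGs-nodes≢⊤ s tube (cong proj₁ eq))

  -- Compatibility of two such tubes depends only on their node sets and on
  -- adjacency, which G and G_s share.
  compatible-toGs : ∀ N₁ N₂ → Compatible G (N₁ , K ∩ induced G N₁) (N₂ , K ∩ induced G N₂) →
                    Compatible Gs (N₁ , induced Gs N₁) (N₂ , induced Gs N₂)
  compatible-toGs N₁ N₂ (inj₁ ((N₁⊆N₂ , _) , ne)) =
    inj₁ ((N₁⊆N₂ , induced-mono Gs N₁⊆N₂) , λ eq → ne (cong (λ N → N , K ∩ induced G N) (cong proj₁ eq)))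
  compatible-toGs N₁ N₂ (inj₂ (inj₁ ((N₂⊆N₁ , _) , ne))) =
    inj₂ (inj₁ ((N₂⊆N₁ , induced-mono Gs N₂⊆N₁) ,
                λ eq → ne (cong (λ N → N , K ∩ induced G N) (cong proj₁ eq))))
  compatible-toGs N₁ N₂ (inj₂ (inj₂ (disjoint , noEdge))) =
    inj₂ (inj₂ (disjoint , λ { (e' , x , y , x∈ , y∈ , joins) →
    noEdge (ι e' , x , y , x∈ , y∈ , subst (λ a → SameBundle a _) (ι-ends e') joins) }))

  compatible-fromGs : ∀ N₁ N₂ → Compatible Gs (N₁ , induced Gs N₁) (N₂ , induced Gs N₂) →
                      Compatible G (N₁ , K ∩ induced G N₁) (N₂ , K ∩ induced G N₂)
  compatible-fromGs N₁ N₂ (inj₁ ((N₁⊆N₂ , _) , ne)) =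
    inj₁ ((N₁⊆N₂ , keptInduced-mono N₁⊆N₂) , λ eq → ne (cong (λ N → N , induced Gs N) (cong proj₁ eq)))
  compatible-fromGs N₁ N₂ (inj₂ (inj₁ ((N₂⊆N₁ , _) , ne))) =
    inj₂ (inj₁ ((N₂⊆N₁ , keptInduced-mono N₂⊆N₁) , λ eq → ne (cong (λ N → N , induced Gs N) (cong proj₁ eq))))
  compatible-fromGs N₁ N₂ (inj₂ (inj₂ (disjoint , noEdge))) =
    inj₂ (inj₂ (disjoint , λ { (e , x , y , x∈ , y∈ , joins) → noEdgeG e x y x∈ y∈ joins }))
    where
    noEdgeG : ∀ e x y → x ∈ N₁ → y ∈ N₂ → Joins G e x y → ⊥
    noEdgeG e x y x∈ y∈ joins with x ≟ y
    ... | yes refl = disjoint x x∈ y∈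
    ... | no x≢y with representative e (sameBundle-nonloop joins x≢y)
    ...   | f , kept-f , f∼e with ι-surjective f kept-f
    ...     | e' , refl = noEdge (e' , x , y , x∈ , y∈ ,
                                      subst (λ a → SameBundle a _) (sym (ι-ends e')) (sameBundle-trans f∼e joins))

-- Tubes of G strictly containing G_s are spanning, so they are G_s plus a
-- proper nonempty set of redundant edges.  Labelling the redundant edges by
-- Fin ρ (ρ = their number), such tubes correspond to proper nonempty
-- subsets of Fin ρ, and inclusion of tubes to inclusion of label sets.
module Supertubes {n : ℕ} (G : Pseudograph n) where
  open Underlying G
  open Redundant G

  ρ : ℕ
  ρ = ∣ redundant ∣

  label : Fin ρ → Edge G
  label = enum redundant

  label∉K : ∀ i → label i ∉ K
  label∉K i label∈K = kept⇒∉redundant _ (∈K⁻ _ label∈K) (enum-∈ redundant i)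

  unkept-labelled : ∀ e → e ∉ K → ∃[ i ] label i ≡ e
  unkept-labelled e e∉K = index redundant e e∈ , enum-index redundant e e∈
    where e∈ : e ∈ redundant
          e∈ with e ∈? redundant
          ... | yes e∈ = e∈
          ... | no e∉ = ⊥-elim (e∉K (∈K⁺ e (∉redundant⇒kept e e∉)))

  labelsOf : Subset (length G) → Subset ρ
  labelsOf E = subsetOf (λ i → label i ∈? E)

  InWithLabels : Subset ρ → Edge G → Set
  InWithLabels S e = e ∈ K ⊎ ∃[ i ] (i ∈ S × label i ≡ e)

  inWithLabels? : ∀ S e → Dec (InWithLabels S e)
  inWithLabels? S e = (e ∈? K) ⊎-dec FinP.any? (λ i → (i ∈? S) ×-dec (label i ≟ e))

  withLabels : Subset ρ → Subset (length G)
  withLabels S = subsetOf (inWithLabels? S)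

  ∈-labelsOf⁺ : ∀ {E i} → label i ∈ E → i ∈ labelsOf E
  ∈-labelsOf⁺ {E} = ∈-subsetOf⁺ (λ i → label i ∈? E)

  ∈-labelsOf⁻ : ∀ {E i} → i ∈ labelsOf E → label i ∈ E
  ∈-labelsOf⁻ {E} = ∈-subsetOf⁻ (λ i → label i ∈? E)

  K⊆withLabels : ∀ S → K ⊆ withLabels S
  K⊆withLabels S e∈K = ∈-subsetOf⁺ (inWithLabels? S) (inj₁ e∈K)

  ∈-withLabels⁺ : ∀ {S i} → i ∈ S → label i ∈ withLabels S
  ∈-withLabels⁺ {S} {i} i∈S = ∈-subsetOf⁺ (inWithLabels? S) (inj₂ (i , i∈S , refl))

  ∈-withLabels⁻ : ∀ {S i} → label i ∈ withLabels S → i ∈ S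
  ∈-withLabels⁻ {S} {i} label∈ with ∈-subsetOf⁻ (inWithLabels? S) label∈
  ... | inj₁ label∈K = ⊥-elim (label∉K i label∈K)
  ... | inj₂ (j , j∈S , label-j≡label-i) = subst (_∈ S) (enum-injective redundant label-j≡label-i) j∈S

  withLabels-labelsOf : ∀ E → K ⊆ E → withLabels (labelsOf E) ≡ E
  withLabels-labelsOf E K⊆E = ⊆-antisym ⊆E E⊆
    where
    ⊆E : withLabels (labelsOf E) ⊆ E
    ⊆E e∈ with ∈-subsetOf⁻ (inWithLabels? (labelsOf E)) e∈
    ... | inj₁ e∈K = K⊆E e∈K
    ... | inj₂ (i , i∈ , refl) = ∈-labelsOf⁻ i∈
    E⊆ : E ⊆ withLabels (labelsOf E)
    E⊆ {e} e∈E with e ∈? K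
    ... | yes e∈K = K⊆withLabels _ e∈K
    ... | no e∉K with unkept-labelled e e∉K
    ...   | i , refl = ∈-withLabels⁺ (∈-labelsOf⁺ e∈E)

  labelsOf-withLabels : ∀ S → labelsOf (withLabels S) ≡ S
  labelsOf-withLabels S = ⊆-antisym (∈-withLabels⁻ ∘ ∈-labelsOf⁻) (∈-labelsOf⁺ ∘ ∈-withLabels⁺)

  labelsOf-mono : ∀ {E E'} → E ⊆ E' → labelsOf E ⊆ labelsOf E'
  labelsOf-mono E⊆E' i∈ = ∈-labelsOf⁺ (E⊆E' (∈-labelsOf⁻ i∈))

  withLabels-mono : ∀ {S S'} → S ⊆ S' → withLabels S ⊆ withLabels S'
  withLabels-mono {S} S⊆S' e∈ with ∈-subsetOf⁻ (inWithLabels? S) e∈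
  ... | inj₁ e∈K = K⊆withLabels _ e∈K
  ... | inj₂ (i , i∈S , refl) = ∈-withLabels⁺ (S⊆S' i∈S)

  withLabels-proper : ∀ S → Proper S → (withLabels S ≢ K) × (withLabels S ≢ ⊤)
  withLabels-proper S ((i , i∈S) , (j , j∉S)) =
    (λ eq → label∉K i (subst (label i ∈_) eq (∈-withLabels⁺ i∈S))) ,
    (λ eq → j∉S (∈-withLabels⁻ (subst (label j ∈_) (sym eq) ∈⊤)))

  labelsOf-proper : ∀ E → K ⊆ E → E ≢ K → E ≢ ⊤ → Proper (labelsOf E)
  labelsOf-proper E K⊆E E≢K E≢⊤ = labelled-member , labelled-nonmember
    where
    labelled-member : ∃[ i ] i ∈ labelsOf E
    labelled-member with ⊈-witness E K (λ E⊆K → E≢K (⊆-antisym E⊆K K⊆E))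
    ... | e , e∈E , e∉K with unkept-labelled e e∉K
    ...   | i , refl = i , ∈-labelsOf⁺ e∈E
    labelled-nonmember : ∃[ i ] i ∉ labelsOf E
    labelled-nonmember with ⊈-witness ⊤ E (λ ⊤⊆E → E≢⊤ (⊆-antisym (λ _ → ∈⊤) ⊤⊆E))
    ... | e , _ , e∉E with unkept-labelled e (λ e∈K → e∉E (K⊆E e∈K))
    ...   | i , refl = i , λ i∈ → e∉E (∈-labelsOf⁻ i∈)

  -- In a connected G, every proper spanning subgraph containing G_s is a
  -- tube: walks reroute through G_s, and G_s contains an edge of every bundle.
  spanning-tube : Connected G → ∀ E → K ⊆ E → E ≢ ⊤ → IsTube G (⊤ , E)
  spanning-tube (x , walks) E K⊆E E≢⊤ =
    (λ _ _ → ∈⊤ , ∈⊤) ,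
    (x , λ a b _ _ → walk-mono K⊆E (walk-viaKept (walks a b ∈⊤ ∈⊤))) ,
    (λ eq → E≢⊤ (cong proj₂ eq)) ,
    λ a b _ _ a≢b (e , joins) → let (f , kept-f , f∼e) = representative e (sameBundle-nonloop joins a≢b)
                               in f , K⊆E (∈K⁺ f kept-f) , sameBundle-trans f∼e joins

module Facet {n : ℕ} (G : Pseudograph n) (connected : Connected G) where
  open Underlying G
  open Redundant G
  open Subtubes G
  open Supertubes G

  infix 4 _⊏_ _⊏?_
  _⊏_ : Sub G → Sub G → Set
  _⊏_ = _⊂ₛ_ G

  _≟ᵗ_ : DecidableEquality (Sub G)
  _≟ᵗ_ = ≡-dec _≟ₛ_ _≟ₛ_

  _⊏?_ : ∀ t t' → Dec (t ⊏ t')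
  (N , E) ⊏? (N' , E') = ((N ⊆? N') ×-dec (E ⊆? E')) ×-dec ¬? ((N , E) ≟ᵗ (N' , E'))

  ⊏-irrefl : ∀ {t} → ¬ (t ⊏ t)
  ⊏-irrefl (_ , t≢t) = t≢t refl

  above : Subset ρ → Sub G
  above S = ⊤ , withLabels S

  tube-∈ : ∀ {T} → IsTubing G T → ∀ {t} → t LM.∈ T → IsTube G t
  tube-∈ tubing = All.lookup (proj₁ tubing)

  -- No tube is disjoint from the spanning tube u, so the tubes of a tubing
  -- containing u are u itself, tubes below u and tubes above u.
  trichotomy : ∀ {T} → IsTubing G T → u LM.∈ T → ∀ {t} → t LM.∈ T → t ≡ u ⊎ t ⊏ u ⊎ u ⊏ t
  trichotomy tubing u∈T {t} t∈T with t ≟ᵗ u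
  ... | yes t≡u = inj₁ t≡u
  ... | no t≢u with proj₂ tubing t u t∈T u∈T t≢u
  ...   | inj₁ t⊏u = inj₂ (inj₁ t⊏u)
  ...   | inj₂ (inj₁ u⊏t) = inj₂ (inj₂ u⊏t)
  ...   | inj₂ (inj₂ (disjoint , _)) =
          let (x , x∈t) = proj₁ (proj₁ (proj₂ (tube-∈ tubing t∈T))) in ⊥-elim (disjoint x x∈t ∈⊤)

  tubeAbove-spanning : ∀ t → u ⊏ t → proj₁ t ≡ ⊤
  tubeAbove-spanning (N , E) ((⊤⊆N , _) , _) = ⊆-antisym (λ _ → ∈⊤) ⊤⊆N

  tubeAbove-form : ∀ t → u ⊏ t → t ≡ above (labelsOf (proj₂ t))
  tubeAbove-form t@(N , E) u⊏t@((_ , K⊆E) , _) =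
    trans (cong (_, E) (tubeAbove-spanning t u⊏t)) (cong (⊤ ,_) (sym (withLabels-labelsOf E K⊆E)))

  tubeAbove-proper : ∀ t → IsTube G t → u ⊏ t → Proper (labelsOf (proj₂ t))
  tubeAbove-proper t@(N , E) (_ , _ , t≢whole , _) u⊏t@((_ , K⊆E) , u≢t) =
    labelsOf-proper E K⊆E (λ E≡K → u≢t (sym (cong₂ _,_ (tubeAbove-spanning t u⊏t) E≡K)))
                          (λ E≡⊤ → t≢whole (cong₂ _,_ (tubeAbove-spanning t u⊏t) E≡⊤))

  belowPart : List (Sub G) → List (Sub Gs)
  belowPart T = map toGs (filter (_⊏? u) T)

  abovePart : List (Sub G) → List (Subset ρ)
  abovePart T = map (labelsOf ∘ proj₂) (filter (u ⊏?_) T)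

  ∈-belowPart⁺ : ∀ {T t} → t LM.∈ T → t ⊏ u → toGs t LM.∈ belowPart T
  ∈-belowPart⁺ t∈T t⊏u = ∈-map⁺ toGs (∈-filter⁺ (_⊏? u) t∈T t⊏u)

  ∈-belowPart⁻ : ∀ {T s} → s LM.∈ belowPart T → ∃[ t ] (t LM.∈ T × t ⊏ u × s ≡ toGs t)
  ∈-belowPart⁻ {T} s∈ with ∈-map⁻ toGs s∈
  ... | t , t∈ , s≡ = let (t∈T , t⊏u) = ∈-filter⁻ (_⊏? u) {xs = T} t∈ in t , t∈T , t⊏u , s≡

  ∈-abovePart⁺ : ∀ {T t} → t LM.∈ T → u ⊏ t → labelsOf (proj₂ t) LM.∈ abovePart T
  ∈-abovePart⁺ t∈T u⊏t = ∈-map⁺ (labelsOf ∘ proj₂) (∈-filter⁺ (u ⊏?_) t∈T u⊏t)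

  ∈-abovePart⁻ : ∀ {T S} → S LM.∈ abovePart T → ∃[ t ] (t LM.∈ T × u ⊏ t × S ≡ labelsOf (proj₂ t))
  ∈-abovePart⁻ {T} S∈ with ∈-map⁻ (labelsOf ∘ proj₂) S∈
  ... | t , t∈ , S≡ = let (t∈T , u⊏t) = ∈-filter⁻ (u ⊏?_) {xs = T} t∈ in t , t∈T , u⊏t , S≡

  belowPart-member : ∀ {T} → IsTubing G T → ∀ {s} → s LM.∈ belowPart T → fromGs s LM.∈ T
  belowPart-member tubing s∈ with ∈-belowPart⁻ s∈
  ... | t , t∈T , t⊏u , refl = subst (LM._∈ _) (tubeBelow-form t (tube-∈ tubing t∈T) t⊏u) t∈T

  abovePart-member : ∀ {T S} → S LM.∈ abovePart T → above S LM.∈ T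
  abovePart-member S∈ with ∈-abovePart⁻ S∈
  ... | t , t∈T , u⊏t , refl = subst (LM._∈ _) (tubeAbove-form t u⊏t) t∈T

  belowPart-mono : ∀ {T T'} → (∀ t → t LM.∈ T' → t LM.∈ T) → ∀ s → s LM.∈ belowPart T' → s LM.∈ belowPart T
  belowPart-mono T'⊆T s s∈ with ∈-belowPart⁻ s∈
  ... | t , t∈T' , t⊏u , refl = ∈-belowPart⁺ (T'⊆T t t∈T') t⊏u

  abovePart-mono : ∀ {T T'} → (∀ t → t LM.∈ T' → t LM.∈ T) → ∀ S → S LM.∈ abovePart T' → S LM.∈ abovePart T
  abovePart-mono T'⊆T S S∈ with ∈-abovePart⁻ S∈
  ... | t , t∈T' , u⊏t , refl = ∈-abovePart⁺ (T'⊆T t t∈T') u⊏t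

  belowPart-tubing : ∀ {T} → IsTubing G T → IsTubing Gs (belowPart T)
  belowPart-tubing {T} tubing = All.tabulate tube , compatible
    where
    tube : ∀ {s} → s LM.∈ belowPart T → IsTube Gs s
    tube s∈ with ∈-belowPart⁻ s∈
    ... | t , t∈T , t⊏u , refl = toGs-tube t (tube-∈ tubing t∈T) t⊏u
    compatible : ∀ s s' → s LM.∈ belowPart T → s' LM.∈ belowPart T → s ≢ s' → Compatible Gs s s'
    compatible s s' s∈ s'∈ s≢s' with ∈-belowPart⁻ s∈ | ∈-belowPart⁻ s'∈
    ... | t , t∈T , t⊏u , refl | t' , t'∈T , t'⊏u , refl =
      compatible-toGs (proj₁ t) (proj₁ t')
        (compatible-subst G (tubeBelow-form t (tube-∈ tubing t∈T) t⊏u) (tubeBelow-form t' (tube-∈ tubing t'∈T) t'⊏u)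
          (proj₂ tubing t t' t∈T t'∈T (λ t≡t' → s≢s' (cong toGs t≡t'))))

  abovePart-proper : ∀ {T} → IsTubing G T → ∀ S → S LM.∈ abovePart T → Proper S
  abovePart-proper tubing S S∈ with ∈-abovePart⁻ S∈
  ... | t , t∈T , u⊏t , refl = tubeAbove-proper t (tube-∈ tubing t∈T) u⊏t

  -- Tubes above u are spanning, hence never disjoint, hence nested.
  abovePart-chain : ∀ {T} → IsTubing G T → ∀ S S' → S LM.∈ abovePart T → S' LM.∈ abovePart T → Comparable S S'
  abovePart-chain tubing S S' S∈ S'∈ with ∈-abovePart⁻ S∈ | ∈-abovePart⁻ S'∈
  ... | t , t∈T , u⊏t , refl | t' , t'∈T , u⊏t' , refl with t ≟ᵗ t'
  ...   | yes refl = inj₁ id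
  ...   | no t≢t' with proj₂ tubing t t' t∈T t'∈T t≢t'
  ...     | inj₁ ((_ , E⊆E') , _) = inj₁ (labelsOf-mono E⊆E')
  ...     | inj₂ (inj₁ ((_ , E'⊆E) , _)) = inj₂ (labelsOf-mono E'⊆E)
  ...     | inj₂ (inj₂ (disjoint , _)) =
            let (x , x∈t) = proj₁ (proj₁ (proj₂ (tube-∈ tubing t∈T)))
            in ⊥-elim (disjoint x x∈t (subst (x ∈_) (sym (tubeAbove-spanning t' u⊏t')) ∈⊤))

  -- From here on G has a redundant edge, so u is a proper subgraph.
  module WithRedundancy (0<ρ : 0 < ρ) where

    K≢⊤ : K ≢ ⊤
    K≢⊤ K≡⊤ = label∉K i (subst (label i ∈_) (sym K≡⊤) ∈⊤)
      where i = fromℕ< 0<ρ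

    u-tube : IsTube G u
    u-tube = spanning-tube connected K id K≢⊤

    above-tube : ∀ S → Proper S → IsTube G (above S)
    above-tube S proper = spanning-tube connected (withLabels S) (K⊆withLabels S) (proj₂ (withLabels-proper S proper))

    u⊏above : ∀ S → Proper S → u ⊏ above S
    u⊏above S proper = (id , K⊆withLabels S) , λ eq → proj₁ (withLabels-proper S proper) (sym (cong proj₂ eq))

    ¬above⊏u : ∀ S → Proper S → ¬ (above S ⊏ u)
    ¬above⊏u S proper ((_ , withLabels⊆K) , _) =
      proj₁ (withLabels-proper S proper) (⊆-antisym withLabels⊆K (K⊆withLabels S))

    fromGs⊏above : ∀ s → IsTube Gs s → ∀ S → fromGs s ⊏ above S
    fromGs⊏above s tube S =
      ((λ _ → ∈⊤) , K⊆withLabels S ∘ proj₂ (proj₁ (fromGs-below s tube))) ,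
      λ eq → tubeGs-nodes≢⊤ s tube (cong proj₁ eq)

    ¬u⊏fromGs : ∀ s → IsTube Gs s → ¬ (u ⊏ fromGs s)
    ¬u⊏fromGs s tube ((⊤⊆N , _) , _) = tubeGs-nodes≢⊤ s tube (⊆-antisym (λ _ → ∈⊤) ⊤⊆N)

    -- The face of 𝒫 ρ whose cuts are the label sets of the tubes above u.
    -- (Kept abstract: only its specification matters, and unfolding the
    -- construction would make type checking needlessly expensive.)
    abstract
      partitionOf : ∀ T → IsTubing G T →
        Σ (OrderedPartition ρ) λ p → ∀ S → (IsCut p S → S LM.∈ abovePart T) × (S LM.∈ abovePart T → IsCut p S)
      partitionOf T tubing = chain⇒partition 0<ρ (abovePart T) (abovePart-proper tubing) (abovePart-chain tubing)

    assemble : List (Sub Gs) → OrderedPartition ρ → List (Sub G)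
    assemble Ts p = u ∷ (map fromGs Ts ++ map above (cuts p))

    AssembledFrom : List (Sub Gs) → OrderedPartition ρ → Sub G → Set
    AssembledFrom Ts p t = t ≡ u ⊎ (∃[ s ] (s LM.∈ Ts × t ≡ fromGs s)) ⊎ (∃[ S ] (IsCut p S × t ≡ above S))

    ∈-assemble⁻ : ∀ Ts p {t} → t LM.∈ assemble Ts p → AssembledFrom Ts p t
    ∈-assemble⁻ Ts p (Any.here t≡u) = inj₁ t≡u
    ∈-assemble⁻ Ts p (Any.there t∈) with ∈-++⁻ (map fromGs Ts) t∈
    ... | inj₁ t∈below = let (s , s∈ , t≡) = ∈-map⁻ fromGs t∈below in inj₂ (inj₁ (s , s∈ , t≡))
    ... | inj₂ t∈above = let (S , S∈ , t≡) = ∈-map⁻ above t∈above in inj₂ (inj₂ (S , ∈-cuts⁻ p S S∈ , t≡))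

    ∈-assemble-fromGs : ∀ Ts p {s} → s LM.∈ Ts → fromGs s LM.∈ assemble Ts p
    ∈-assemble-fromGs Ts p s∈ = Any.there (∈-++⁺ˡ (∈-map⁺ fromGs s∈))

    ∈-assemble-above : ∀ Ts p {S} → IsCut p S → above S LM.∈ assemble Ts p
    ∈-assemble-above Ts p {S} S-cut = Any.there (∈-++⁺ʳ (map fromGs Ts) (∈-map⁺ above (∈-cuts⁺ p S S-cut)))

    assemble-tubing : ∀ {Ts} → IsTubing Gs Ts → ∀ p → IsTubing G (assemble Ts p)
    assemble-tubing {Ts} tubing p = All.tabulate (λ t∈ → tube (∈-assemble⁻ Ts p t∈)) , compatible
      where
      tubeGs : ∀ {s} → s LM.∈ Ts → IsTube Gs s
      tubeGs = All.lookup (proj₁ tubing)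
      tube : ∀ {t} → AssembledFrom Ts p t → IsTube G t
      tube (inj₁ refl) = u-tube
      tube (inj₂ (inj₁ (s , s∈ , refl))) = fromGs-tube s (tubeGs s∈)
      tube (inj₂ (inj₂ (S , S-cut , refl))) = above-tube S (cut-proper p S S-cut)
      compatible′ : ∀ t t' → AssembledFrom Ts p t → AssembledFrom Ts p t' → t ≢ t' → Compatible G t t'
      compatible′ t t' (inj₁ refl) (inj₁ refl) t≢t' = ⊥-elim (t≢t' refl)
      compatible′ t t' (inj₁ refl) (inj₂ (inj₁ (s , s∈ , refl))) _ = inj₂ (inj₁ (fromGs-below s (tubeGs s∈)))
      compatible′ t t' (inj₁ refl) (inj₂ (inj₂ (S , S-cut , refl))) _ = inj₁ (u⊏above S (cut-proper p S S-cut))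
      compatible′ t t' (inj₂ (inj₁ (s , s∈ , refl))) (inj₁ refl) _ = inj₁ (fromGs-below s (tubeGs s∈))
      compatible′ t t' (inj₂ (inj₂ (S , S-cut , refl))) (inj₁ refl) _ = inj₂ (inj₁ (u⊏above S (cut-proper p S S-cut)))
      compatible′ t t' (inj₂ (inj₁ (s , s∈ , refl))) (inj₂ (inj₂ (S , _ , refl))) _ =
        inj₁ (fromGs⊏above s (tubeGs s∈) S)
      compatible′ t t' (inj₂ (inj₂ (S , _ , refl))) (inj₂ (inj₁ (s , s∈ , refl))) _ =
        inj₂ (inj₁ (fromGs⊏above s (tubeGs s∈) S))
      compatible′ t t' (inj₂ (inj₁ (s , s∈ , refl))) (inj₂ (inj₁ (s' , s'∈ , refl))) t≢t' =
        compatible-fromGs (proj₁ s) (proj₁ s')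
          (compatible-subst Gs (tubeGs-form s (tubeGs s∈)) (tubeGs-form s' (tubeGs s'∈))
            (proj₂ tubing s s' s∈ s'∈ (λ s≡s' → t≢t' (cong fromGs s≡s'))))
      compatible′ t t' (inj₂ (inj₂ (S , S-cut , refl))) (inj₂ (inj₂ (S' , S'-cut , refl))) t≢t'
        with cut-comparable p S S' S-cut S'-cut
      ... | inj₁ S⊆S' = inj₁ ((id , withLabels-mono S⊆S') , t≢t')
      ... | inj₂ S'⊆S = inj₂ (inj₁ ((id , withLabels-mono S'⊆S) , t≢t' ∘ sym))
      compatible : ∀ t t' → t LM.∈ assemble Ts p → t' LM.∈ assemble Ts p → t ≢ t' → Compatible G t t'
      compatible t t' t∈ t'∈ = compatible′ t t' (∈-assemble⁻ Ts p t∈) (∈-assemble⁻ Ts p t'∈)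

    partition : ∀ T → IsTubing G T → OrderedPartition ρ
    partition T tubing = proj₁ (partitionOf T tubing)

    facetFace→ : Face (facet G u) → Face (𝒦 Gs ×ᴾ 𝒫 ρ)
    facetFace→ ((T , tubing) , _) = (belowPart T , belowPart-tubing tubing) , partition T tubing

    facetFace← : Face (𝒦 Gs ×ᴾ 𝒫 ρ) → Face (facet G u)
    facetFace← ((Ts , tubing) , p) = (assemble Ts p , assemble-tubing tubing p) , Any.here refl

    cut⇒abovePart : ∀ T tubing S → IsCut (partition T tubing) S → S LM.∈ abovePart T
    cut⇒abovePart T tubing S = proj₁ (proj₂ (partitionOf T tubing) S)

    abovePart⇒cut : ∀ T tubing S → S LM.∈ abovePart T → IsCut (partition T tubing) S
    abovePart⇒cut T tubing S = proj₂ (proj₂ (partitionOf T tubing) S)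

    -- Fewer tubes give fewer tubes below u and fewer cuts, i.e. a coarser
    -- partition; and conversely, since each tube is recovered from its part.
    facetFace→-mono : ∀ x y → _⊑_ (facet G u) x y → _⊑_ (𝒦 Gs ×ᴾ 𝒫 ρ) (facetFace→ x) (facetFace→ y)
    facetFace→-mono ((Tx , tubingx) , _) ((Ty , tubingy) , _) Ty⊆Tx =
      belowPart-mono Ty⊆Tx ,
      cuts⇒⊑ (partition Tx tubingx) (partition Ty tubingy)
        (λ S S-cut → abovePart⇒cut Tx tubingx S (abovePart-mono Ty⊆Tx S (cut⇒abovePart Ty tubingy S S-cut)))

    facetFace→-reflects : ∀ x y → _⊑_ (𝒦 Gs ×ᴾ 𝒫 ρ) (facetFace→ x) (facetFace→ y) → _⊑_ (facet G u) x y
    facetFace→-reflects ((Tx , tubingx) , u∈Tx) ((Ty , tubingy) , u∈Ty) (belowTy⊆belowTx , px⊑py) t t∈Ty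
      with trichotomy tubingy u∈Ty t∈Ty
    ... | inj₁ refl = u∈Tx
    ... | inj₂ (inj₁ t⊏u) =
          subst (LM._∈ Tx) (sym (tubeBelow-form t (tube-∈ tubingy t∈Ty) t⊏u))
                (belowPart-member tubingx (belowTy⊆belowTx _ (∈-belowPart⁺ t∈Ty t⊏u)))
    ... | inj₂ (inj₂ u⊏t) =
          subst (LM._∈ Tx) (sym (tubeAbove-form t u⊏t))
                (abovePart-member (cut⇒abovePart Tx tubingx _
                  (⊑⇒cuts (partition Tx tubingx) (partition Ty tubingy) px⊑py _
                    (abovePart⇒cut Ty tubingy _ (∈-abovePart⁺ t∈Ty u⊏t)))))

    facetFace←→ : ∀ x → _⊑_ (facet G u) (facetFace← (facetFace→ x)) x ×
                        _⊑_ (facet G u) x (facetFace← (facetFace→ x))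
    facetFace←→ ((T , tubing) , u∈T) = T⊆assembled , assembled⊆T
      where
      p = partition T tubing
      T⊆assembled : ∀ t → t LM.∈ T → t LM.∈ assemble (belowPart T) p
      T⊆assembled t t∈T with trichotomy tubing u∈T t∈T
      ... | inj₁ refl = Any.here refl
      ... | inj₂ (inj₁ t⊏u) = subst (LM._∈ _) (sym (tubeBelow-form t (tube-∈ tubing t∈T) t⊏u))
                                 (∈-assemble-fromGs (belowPart T) p (∈-belowPart⁺ t∈T t⊏u))
      ... | inj₂ (inj₂ u⊏t) = subst (LM._∈ _) (sym (tubeAbove-form t u⊏t))
                                 (∈-assemble-above (belowPart T) p (abovePart⇒cut T tubing _ (∈-abovePart⁺ t∈T u⊏t)))
      assembled⊆T : ∀ t → t LM.∈ assemble (belowPart T) p → t LM.∈ T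
      assembled⊆T t t∈ with ∈-assemble⁻ (belowPart T) p t∈
      ... | inj₁ refl = u∈T
      ... | inj₂ (inj₁ (s , s∈ , refl)) = belowPart-member tubing s∈
      ... | inj₂ (inj₂ (S , S-cut , refl)) = abovePart-member (cut⇒abovePart T tubing S S-cut)

    facetFace→← : ∀ y → _⊑_ (𝒦 Gs ×ᴾ 𝒫 ρ) (facetFace→ (facetFace← y)) y ×
                        _⊑_ (𝒦 Gs ×ᴾ 𝒫 ρ) y (facetFace→ (facetFace← y))
    facetFace→← ((Ts , tubingGs) , p) =
      (Ts⊆below , cuts⇒⊑ p′ p cuts⊆cuts′) , (below⊆Ts , cuts⇒⊑ p p′ cuts′⊆cuts)
      where
      F = assemble Ts p
      tubingF = assemble-tubing tubingGs p
      p′ = partition F tubingF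
      tubeGs : ∀ {s} → s LM.∈ Ts → IsTube Gs s
      tubeGs = All.lookup (proj₁ tubingGs)
      Ts⊆below : ∀ s → s LM.∈ Ts → s LM.∈ belowPart F
      Ts⊆below s s∈ = subst (LM._∈ belowPart F) (sym (tubeGs-form s (tubeGs s∈)))
                        (∈-belowPart⁺ (∈-assemble-fromGs Ts p s∈) (fromGs-below s (tubeGs s∈)))
      below⊆Ts : ∀ s → s LM.∈ belowPart F → s LM.∈ Ts
      below⊆Ts s s∈ with ∈-belowPart⁻ s∈
      ... | t , t∈F , t⊏u , refl with ∈-assemble⁻ Ts p t∈F
      ...   | inj₁ refl = ⊥-elim (⊏-irrefl t⊏u)
      ...   | inj₂ (inj₁ (s' , s'∈ , refl)) = subst (LM._∈ Ts) (tubeGs-form s' (tubeGs s'∈)) s'∈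
      ...   | inj₂ (inj₂ (S , S-cut , refl)) = ⊥-elim (¬above⊏u S (cut-proper p S S-cut) t⊏u)
      cuts⊆cuts′ : ∀ S → IsCut p S → IsCut p′ S
      cuts⊆cuts′ S S-cut = abovePart⇒cut F tubingF S
        (subst (LM._∈ abovePart F) (labelsOf-withLabels S)
          (∈-abovePart⁺ (∈-assemble-above Ts p S-cut) (u⊏above S (cut-proper p S S-cut))))
      cuts′⊆cuts : ∀ S → IsCut p′ S → IsCut p S
      cuts′⊆cuts S S-cut with ∈-abovePart⁻ (cut⇒abovePart F tubingF S S-cut)
      ... | t , t∈F , u⊏t , refl with ∈-assemble⁻ Ts p t∈F
      ...   | inj₁ refl = ⊥-elim (⊏-irrefl u⊏t)
      ...   | inj₂ (inj₁ (s , s∈ , refl)) = ⊥-elim (¬u⊏fromGs s (tubeGs s∈) u⊏t)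
      ...   | inj₂ (inj₂ (S' , S'-cut , refl)) = subst (IsCut p) (sym (labelsOf-withLabels S')) S'-cut

    facet≅ : facet G u ≅ (𝒦 Gs ×ᴾ 𝒫 ρ)
    facet≅ = record
      { to = facetFace→ ; from = facetFace← ; to-mono = facetFace→-mono ; to-refl = facetFace→-reflects
      ; from-to = facetFace←→ ; to-from = facetFace→← }

-- The facet isomorphism, with ρ identified with r by minimality of the
-- redundant edge set.
corollary9 : ∀ (n : ℕ) (G : Pseudograph n) (r : ℕ) →
    Connected G → RedundantCount G r → 1 ≤ r →
    facet G (underlyingTube G) ≅ (𝒦 (underlying G) ×ᴾ 𝒫 r)
corollary9 n G r connected count 1≤r =
  subst (λ k → facet G (underlyingTube G) ≅ (𝒦 (underlying G) ×ᴾ 𝒫 k)) ρ≡r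
    (Facet.WithRedundancy.facet≅ G connected (subst (1 ≤_) (sym ρ≡r) 1≤r))
  where
  ρ≡r : Supertubes.ρ G ≡ r
  ρ≡r = Redundant.redundant-count G r count
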